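{- Let $\mathbf{k}$ be a commutative ring, $n\ge1$, and let $w,u\in S_n$. Set $\beta=\operatorname{cLRM}'(w)$ and $\gamma=\operatorname{cLRM}'(u)$. Then: (a) the coefficient of the word $\underline{w}$ in $\mathbf{V}_\beta\mathbf{B}_\beta w$ equals $1$; (b) if $u\ne w$ and $\widetilde{\beta}\prec_\pi\widetilde{\gamma}$ does not hold, then the coefficient of $\underline{w}$ in $\mathbf{V}_\beta\mathbf{B}_\gamma u$ equals $0$.
   Context: $S_n$ is the symmetric group on $[n]$, product $(uw)(i)=u(w(i))$. $F_n$ is the free associative $\mathbf{k}$-algebra on noncommuting letters $\underline1,\dots,\underline n$; $F_{n,n}$ is its span of length-$n$ words. $S_n$ acts on $F_{n,n}$ from the right by $(\underline{w_1}\cdots\underline{w_n})\cdot\sigma=\underline{w_{\sigma(1)}}\cdots\underline{w_{\sigma(n)}}$, extended to a right $\mathbf{k}[S_n]$-action; expressions $\mathbf{V}_\beta\mathbf{B}_\gamma u$ mean $(\mathbf{V}_\beta\cdot\mathbf{B}_\gamma)\cdot u$. For $\sigma\in S_n$, $\underline\sigma=\underline{\sigma(1)}\cdots\underline{\sigma(n)}$. $[a,b]=ab-ba$; for nonempty $S\subseteq[n]$ with elements $s_1<\dots<s_k$, $V^S=[[\cdots[\underline{s_1},\underline{s_2}],\dots],\underline{s_k}]$. For a composition $\alpha=(\alpha_1,\dots,\alpha_p)$ of $n$, $\alpha_{\le i}=\alpha_1+\cdots+\alpha_i$, $\operatorname{Set}(\alpha)_i=\{\alpha_{\le i-1}+1,\dots,\alpha_{\le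 i}\}$, $\mathbf{V}_\alpha=V^{\operatorname{Set}(\alpha)_1}\cdots V^{\operatorname{Set}(\alpha)_p}$, and $\mathbf{B}_\alpha=\sum_{\sigma\in S_n,\ \operatorname{Des}(\sigma)\subseteq\{\alpha_{\le1},\dots,\alpha_{\le p-1}\}}\sigma$, where $\operatorname{Des}(\sigma)=\{i\in[n-1]\mid\sigma(i)>\sigma(i+1)\}$. For $I=\{i_1<\dots<i_{p-1}\}\subseteq[n-1]$, $\operatorname{Comp}(I)=(i_1-i_0,\dots,i_p-i_{p-1})$ with $i_0=0,i_p=n$. $\operatorname{LRM}(w)=\{i\in[n]\mid w(k)>i\text{ for all }k<w^{ -1}(i)\}$, $\operatorname{LRM}'(w)=\{\ell-1\mid\ell\in\operatorname{LRM}(w),\ \ell>1\}$, $\operatorname{cLRM}'(w)=\operatorname{Comp}(\operatorname{LRM}'(w))$. $\widetilde\alpha$ is the partition obtained by sorting the parts of $\alpha$ decreasingly. For partitions $\lambda=(\lambda_1,\dots,\lambda_k)$, $\mu=(\mu_1,\dots,\mu_l)$, $\lambda\preceq_\pi\mu$ means there is $f:[k]\to[l]$ with $\mu_j=\sum_{i\in f^{ -1}(j)}\lambda_i$ for all $j$; $\lambda\prec_\pi\mu$ means $\lambda\preceq_\pi\mu$ and $\lambda\ne\mu$. -}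

module Defs where

open import Level using (Level)
open import Data.Bool using (Bool; true; false; _∧_; _∨_; not; if_then_else_)
open import Data.Nat using (ℕ; zero; suc; _+_; _∸_; _<ᵇ_; _≡ᵇ_; _≤ᵇ_)
open import Data.Fin using (Fin; toℕ)
open import Data.Fin.Permutation using (Permutation′; _⟨$⟩ʳ_; _⟨$⟩ˡ_)
open import Data.List using (List; []; _∷_; _++_; map; concatMap; foldr; allFin; filterᵇ; length; lookup)
open import Data.List.Properties using (≡-dec)
open import Data.Nat.Properties using () renaming (_≟_ to _≟ℕ_)
open import Data.Vec using (Vec; []; _∷_)
import Data.Vec as V
open import Data.Product using (_×_; _,_; ∃)
open import Relation.Binary.PropositionalEquality using (_≡_)
open import Relation.Nullary using (¬_; does)
open import Algebra.Bundles using (CommutativeRing)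

-- Combinatorics of permutations.  Positions and values of a permutation
-- of [n] are represented by Fin n; the element i : Fin n stands for the
-- number toℕ i + 1 ∈ [n].

allᵇ : ∀ {a} {A : Set a} → (A → Bool) → List A → Bool
allᵇ p = foldr (λ x b → p x ∧ b) true

anyᵇ : ∀ {a} {A : Set a} → (A → Bool) → List A → Bool
anyᵇ p = foldr (λ x b → p x ∨ b) false

valuesOf : ∀ {n} → (Fin n → Fin n) → List ℕ
valuesOf {n} σ = map (λ i → suc (toℕ (σ i))) (allFin n)

isLRM : ∀ {n} → Permutation′ n → Fin n → Bool
isLRM {n} w ℓ =
  allᵇ (λ k → if toℕ k <ᵇ toℕ (w ⟨$⟩ˡ ℓ) then toℕ ℓ <ᵇ toℕ (w ⟨$⟩ʳ k) else true)
      (allFin n)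

-- LRM'(w) = { ℓ - 1 | ℓ ∈ LRM(w), ℓ > 1 }, as an increasing list of naturals.
-- (For ℓ : Fin n standing for the number toℕ ℓ + 1, the number ℓ-1 is toℕ ℓ.)
LRM′ : ∀ {n} → Permutation′ n → List ℕ
LRM′ {n} w = map toℕ (filterᵇ (λ ℓ → (1 ≤ᵇ toℕ ℓ) ∧ isLRM w ℓ) (allFin n))

-- Comp(I) for I = {i₁ < … < i_{p-1}} ⊆ [n-1] given as an increasing list
compDiffs : ℕ → ℕ → List ℕ → List ℕ
compDiffs n prev []       = (n ∸ prev) ∷ []
compDiffs n prev (i ∷ is) = (i ∸ prev) ∷ compDiffs n i is

Comp : ℕ → List ℕ → List ℕ
Comp n I = compDiffs n 0 I

cLRM′ : ∀ {n} → Permutation′ n → List ℕ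
cLRM′ {n} w = Comp n (LRM′ w)

partialSumsFrom : ℕ → List ℕ → List ℕ
partialSumsFrom s []           = []
partialSumsFrom s (a ∷ [])     = []
partialSumsFrom s (a ∷ b ∷ as) = (s + a) ∷ partialSumsFrom (s + a) (b ∷ as)

partialSums : List ℕ → List ℕ
partialSums α = partialSumsFrom 0 α

interval : ℕ → ℕ → List ℕ
interval s zero    = []
interval s (suc a) = suc s ∷ interval (suc s) a

setsFrom : ℕ → List ℕ → List (List ℕ)
setsFrom s []       = []
setsFrom s (a ∷ as) = interval s a ∷ setsFrom (s + a) as

Sets : List ℕ → List (List ℕ)
Sets α = setsFrom 0 α

desFrom : ℕ → List ℕ → List ℕ
desFrom i []           = []
desFrom i (x ∷ [])     = []
desFrom i (x ∷ y ∷ xs) =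
  (if y <ᵇ x then i ∷ [] else []) ++ desFrom (suc i) (y ∷ xs)

Des : ∀ {n} → (Fin n → Fin n) → List ℕ
Des σ = desFrom 1 (valuesOf σ)

memℕ : ℕ → List ℕ → Bool
memℕ x = anyᵇ (λ y → x ≡ᵇ y)

-- S_n, enumerated once each: all injective maps Fin n → Fin n
-- (as the lookup functions of the vectors with pairwise distinct entries).
allVecs : (n m : ℕ) → List (Vec (Fin n) m)
allVecs n zero    = [] ∷ []
allVecs n (suc m) = concatMap (λ v → map (λ x → x ∷ v) (allFin n)) (allVecs n m)

injectiveᵇ : ∀ {n} → (Fin n → Fin n) → Bool
injectiveᵇ {n} σ =
  allᵇ (λ i → allᵇ (λ j → (toℕ i ≡ᵇ toℕ j) ∨ not (toℕ (σ i) ≡ᵇ toℕ (σ j))) (allFin n))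
      (allFin n)

Sym : (n : ℕ) → List (Fin n → Fin n)
Sym n = filterᵇ injectiveᵇ (map V.lookup (allVecs n n))

BSet : (n : ℕ) → List ℕ → List (Fin n → Fin n)
BSet n α = filterᵇ (λ σ → allᵇ (λ d → memℕ d (partialSums α)) (Des σ)) (Sym n)

insertDec : ℕ → List ℕ → List ℕ
insertDec x []       = x ∷ []
insertDec x (y ∷ ys) = if y <ᵇ x then x ∷ y ∷ ys else y ∷ insertDec x ys

sortDec : List ℕ → List ℕ
sortDec = foldr insertDec []

sumℕ : List ℕ → ℕ
sumℕ = foldr _+_ 0

_⪯π_ : List ℕ → List ℕ → Set
λ′ ⪯π μ = ∃ λ (f : Fin (length λ′) → Fin (length μ)) →
  ∀ (j : Fin (length μ)) →
    lookup μ j ≡ sumℕ (map (λ i → if toℕ (f i) ≡ᵇ toℕ j then lookup λ′ i else 0)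
                          (allFin (length λ′)))

_≺π_ : List ℕ → List ℕ → Set
λ′ ≺π μ = (λ′ ⪯π μ) × ¬ (λ′ ≡ μ)

-- The free algebra F_n over a commutative ring, as formal finite sums of
-- words (a word is a list of letters; letter i is the natural number i).

module FreeAlg {c ℓ : Level} (R : CommutativeRing c ℓ) where
  open CommutativeRing R renaming (_+_ to _+ᴿ_)

  Word : Set
  Word = List ℕ

  F : Set c
  F = List (Carrier × Word)

  letter : ℕ → F
  letter i = (1# , i ∷ []) ∷ []

  one : F
  one = (1# , []) ∷ []

  _⊕_ : F → F → F
  x ⊕ y = x ++ y

  neg : F → F
  neg = map (λ { (a , v) → (- a , v) })

  _⊗_ : F → F → F
  x ⊗ y = concatMap (λ { (a , v) → map (λ { (b , v′) → (a * b , v ++ v′) }) y }) x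

  bracket : F → F → F
  bracket x y = (x ⊗ y) ⊕ neg (y ⊗ x)

  VS : List ℕ → F
  VS []       = one
  VS (s ∷ ss) = Data.List.foldl (λ acc t → bracket acc (letter t)) (letter s) ss

  Vbold : List ℕ → F
  Vbold α = foldr _⊗_ one (map VS (Sets α))

  coeff : F → Word → Carrier
  coeff x w = foldr (λ { (a , v) acc → (if does (≡-dec _≟ℕ_ v w) then a else 0#) +ᴿ acc }) 0# x

  -- right action of σ on a word of length n: (w₁⋯wₙ)·σ = w_{σ(1)}⋯w_{σ(n)}
  nth : Word → ℕ → ℕ
  nth []       _       = 0
  nth (x ∷ xs) zero    = x
  nth (x ∷ xs) (suc k) = nth xs k

  actWord : ∀ {n} → Word → (Fin n → Fin n) → Word
  actWord {n} w σ = map (λ i → nth w (toℕ (σ i))) (allFin n)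

  act : ∀ {n} → F → (Fin n → Fin n) → F
  act x σ = map (λ { (a , v) → (a , actWord v σ) }) x

  -- linear extension to k[S_n]: x · (σ₁ + … + σ_m)
  actSum : ∀ {n} → F → List (Fin n → Fin n) → F
  actSum x σs = concatMap (act x) σs

  underline : ∀ {n} → Permutation′ n → Word
  underline w = valuesOf (w ⟨$⟩ʳ_)

  VBu : (n : ℕ) → List ℕ → List ℕ → Permutation′ n → F
  VBu n β γ u = act (actSum (Vbold β) (BSet n γ)) (u ⟨$⟩ʳ_)

-- For a word v of V_β, a rearrangement of 1, …, n, exactly one σ gives (v · σ) · u = w,
-- and σ ∈ B_γ exactly when v respects the precedence constraints π i before π (i + 1)
-- for i + 1 ∉ LRM′ u, where π = w ∘ u⁻¹.  So the coefficient is the total weight of the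
-- words of V_β respecting these constraints.  V_β is the product of the left-normed Lie
-- monomials on the w-blocks (the runs of values opened by left-to-right minima of w), and
-- this weight factors over the blocks.  Constraints never leave a u-block, so a Lie monomial
-- whose letters meet two u-blocks (colours) weighs 0; one whose letters are chained by
-- constraints weighs 1 if they all ascend and 0 if one descends.  For u = w every block is
-- chained and ascending, giving (a).  For (b): if some w-block is two-coloured we are done;
-- otherwise the w-blocks refine the u-blocks, so β̃ ⪯ γ̃, with equality only if colours
-- separate the w-blocks.  Then every w-block is chained, and either a constraint descends,
-- or all ascend, π is increasing and u = w.

module Submission where

open import Defs
open import Level using (Level)
open import Algebra.Bundles using (CommutativeRing)
open import Data.Bool using (Bool; true; false; _∧_; _∨_; not; if_then_else_; T)
open import Data.Bool.Properties using (∧-identityʳ; ∧-zeroʳ; ∨-assoc; ∨-comm; not-involutive; ∨-∧-booleanAlgebra)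
open import Algebra.Lattice.Properties.BooleanAlgebra ∨-∧-booleanAlgebra using (deMorgan₂)
open import Data.Empty using (⊥; ⊥-elim)
open import Data.Fin using (Fin; toℕ; inject₁; fromℕ<; punchIn; punchOut) renaming (zero to fzero; suc to fsuc)
import Data.Fin.Properties as Fin
open import Data.Fin.Permutation
  using (Permutation′; _⟨$⟩ʳ_; _⟨$⟩ˡ_; inverseˡ; inverseʳ; flip; _∘ₚ_)
open import Data.Nat using (ℕ; zero; suc; _+_; _*_; _∸_; _<_; _≤_; _≰_; _≡ᵇ_; _<ᵇ_; _≤ᵇ_; z≤n; s≤s)
import Data.Nat.Properties as ℕ
open import Algebra.Properties.Semiring.Sum ℕ.+-*-semiring
  using (sum; sum-cong-≗; sum-permute; ∑-comm; *-distribʳ-sum; sum-replicate-zero)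
open import Data.List
  using (List; []; _∷_; _++_; [_]; _∷ʳ_; map; concatMap; foldr; filterᵇ; allFin; tabulate; length; lookup)
open import Data.List.Properties using (foldl-∷ʳ; map-tabulate; map-cong; ≡-dec)
open import Data.List.Membership.Propositional using (_∈_; _∉_; find; lose)
open import Data.List.Membership.Propositional.Properties
  using (∈-++⁺ˡ; ∈-++⁺ʳ; ∈-++⁻; ∈-map⁺; ∈-map⁻; ∈-filter⁺; ∈-filter⁻; ∈-map∘filter⁻; ∈-map∘filter⁺; ∈-allFin)
open import Data.List.Relation.Binary.Disjoint.Propositional using (Disjoint)
open import Data.List.Relation.Binary.Permutation.Propositional
  using (_↭_; prep; swap; ↭-refl; ↭-sym; ↭-trans; ↭⇒↭ₛ)
open import Data.List.Relation.Binary.Permutation.Propositional.Properties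
  using (∈-resp-↭; ↭-length; ∷↭∷ʳ) renaming (++⁺ to ++⁺-↭)
open import Data.List.Relation.Unary.All as All using (All; []; _∷_)
open import Data.List.Relation.Unary.All.Properties using (++⁺; map⁺; ¬All⇒Any¬)
open import Data.List.Relation.Unary.AllPairs as AllPairs using (AllPairs; []; _∷_)
import Data.List.Relation.Unary.AllPairs.Properties as AllPairs
open import Data.List.Relation.Unary.Any as Any using (Any; here; there)
open import Data.List.Relation.Unary.Unique.Propositional using (Unique)
open import Data.Product using (_×_; _,_; proj₁; proj₂; ∃; ∃₂)
open import Data.Sum using (_⊎_; inj₁; inj₂) renaming (map to ⊎-map)
open import Data.Vec using (Vec; []; _∷_)
import Data.Vec as Vec
import Data.Vec.Properties as Vec
open import Function using (_∘_; id)
open import Relation.Binary using (tri<; tri≈; tri>)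
open import Relation.Binary.PropositionalEquality
  using (_≡_; _≢_; refl; sym; trans; cong; cong₂; subst; subst₂; module ≡-Reasoning)
  renaming (setoid to ≡-setoid)
open import Data.List.Relation.Binary.Permutation.Setoid (≡-setoid ℕ) using (onIndices)
open import Data.List.Relation.Binary.Permutation.Setoid.Properties (≡-setoid ℕ)
  using (onIndices-lookup; Unique-resp-↭)
open import Relation.Nullary using (¬_; Dec; yes; no; does; proof; Reflects; ofʸ; ofⁿ)
open import Relation.Nullary.Decidable using (dec-true; _→-dec_)
open import Relation.Nullary.Decidable.Core using (T?)
open import Relation.Nullary.Reflects using (fromEquivalence; _×-reflects_)

private
  variable
    a b : Level
    A : Set a
    B : Set b

≡ᵇ-reflects : ∀ m n → Reflects (m ≡ n) (m ≡ᵇ n)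
≡ᵇ-reflects m n = fromEquivalence (ℕ.≡ᵇ⇒≡ m n) (ℕ.≡⇒≡ᵇ m n)

reflects-true : ∀ {p} {P : Set p} {b} → Reflects P b → P → b ≡ true
reflects-true (ofʸ _) _ = refl
reflects-true (ofⁿ ¬p) p = ⊥-elim (¬p p)

reflects-false : ∀ {p} {P : Set p} {b} → Reflects P b → ¬ P → b ≡ false
reflects-false (ofʸ p) ¬p = ⊥-elim (¬p p)
reflects-false (ofⁿ _) _ = refl

reflects-witness : ∀ {p} {P : Set p} {b} → Reflects P b → b ≡ true → P
reflects-witness (ofʸ p) _ = p

reflects-map : ∀ {p q} {P : Set p} {Q : Set q} {b} → (P → Q) → (Q → P) → Reflects P b → Reflects Q b
reflects-map f g (ofʸ p) = ofʸ (f p)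
reflects-map f g (ofⁿ ¬p) = ofⁿ (¬p ∘ g)

reflects-≡ : ∀ {p q} {P : Set p} {Q : Set q} {a b} → Reflects P a → Reflects Q b → (P → Q) → (Q → P) → a ≡ b
reflects-≡ (ofʸ _) (ofʸ _) _ _ = refl
reflects-≡ (ofʸ p) (ofⁿ ¬q) f _ = ⊥-elim (¬q (f p))
reflects-≡ (ofⁿ ¬p) (ofʸ q) _ g = ⊥-elim (¬p (g q))
reflects-≡ (ofⁿ _) (ofⁿ _) _ _ = refl

Fin-≡ᵇ-reflects : ∀ {k} (a b : Fin k) → Reflects (a ≡ b) (toℕ a ≡ᵇ toℕ b)
Fin-≡ᵇ-reflects a b = reflects-map Fin.toℕ-injective (cong toℕ) (≡ᵇ-reflects (toℕ a) (toℕ b))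

anyᵇ-reflects : ∀ {p} {P : A → Set p} {q : A → Bool} →
                (∀ x → Reflects (P x) (q x)) → ∀ xs → Reflects (Any P xs) (anyᵇ q xs)
anyᵇ-reflects r [] = ofⁿ λ ()
anyᵇ-reflects {q = q} r (x ∷ xs) with q x | r x
... | true  | ofʸ px = ofʸ (here px)
... | false | ofⁿ ¬px with anyᵇ q xs | anyᵇ-reflects r xs
...   | true  | ofʸ pxs  = ofʸ (there pxs)
...   | false | ofⁿ ¬pxs = ofⁿ λ { (here px) → ¬px px ; (there pxs) → ¬pxs pxs }

allᵇ-reflects : ∀ {p} {P : A → Set p} {q : A → Bool} →
                (∀ x → Reflects (P x) (q x)) → ∀ xs → Reflects (All P xs) (allᵇ q xs)
allᵇ-reflects r [] = ofʸ []
allᵇ-reflects {q = q} r (x ∷ xs) with q x | r x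
... | false | ofⁿ ¬px = ofⁿ (¬px ∘ All.head)
... | true  | ofʸ px with allᵇ q xs | allᵇ-reflects r xs
...   | true  | ofʸ pxs  = ofʸ (px ∷ pxs)
...   | false | ofⁿ ¬pxs = ofⁿ (¬pxs ∘ All.tail)

if-reflects : ∀ {p q} {P : Set p} {Q : Set q} {a b} → Reflects P a → Reflects Q b → Reflects (P → Q) (if a then b else true)
if-reflects (ofʸ p) (ofʸ q) = ofʸ λ _ → q
if-reflects (ofʸ p) (ofⁿ ¬q) = ofⁿ λ f → ¬q (f p)
if-reflects (ofⁿ ¬p) _ = ofʸ λ p → ⊥-elim (¬p p)

memℕ-reflects : ∀ x xs → Reflects (x ∈ xs) (memℕ x xs)
memℕ-reflects x = anyᵇ-reflects (≡ᵇ-reflects x)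

∈⇒memℕ : ∀ {x xs} → x ∈ xs → memℕ x xs ≡ true
∈⇒memℕ {x} {xs} = reflects-true (memℕ-reflects x xs)

∉⇒memℕ : ∀ {x xs} → x ∉ xs → memℕ x xs ≡ false
∉⇒memℕ {x} {xs} = reflects-false (memℕ-reflects x xs)

memℕ-++ : ∀ x v v′ → memℕ x (v ++ v′) ≡ memℕ x v ∨ memℕ x v′
memℕ-++ x [] v′ = refl
memℕ-++ x (z ∷ zs) v′ = trans (cong ((x ≡ᵇ z) ∨_) (memℕ-++ x zs v′)) (sym (∨-assoc (x ≡ᵇ z) _ _))

allᵇ-true : ∀ {q : A → Bool} → (∀ x → q x ≡ true) → ∀ xs → allᵇ q xs ≡ true
allᵇ-true h [] = refl
allᵇ-true h (x ∷ xs) rewrite h x = allᵇ-true h xs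

allᵇ-++ : ∀ (q : A → Bool) xs ys → allᵇ q (xs ++ ys) ≡ allᵇ q xs ∧ allᵇ q ys
allᵇ-++ q [] ys = refl
allᵇ-++ q (x ∷ xs) ys rewrite allᵇ-++ q xs ys with q x
... | true  = refl
... | false = refl

allᵇ-map : ∀ (q : B → Bool) (f : A → B) xs → allᵇ q (map f xs) ≡ allᵇ (q ∘ f) xs
allᵇ-map q f [] = refl
allᵇ-map q f (x ∷ xs) = cong (q (f x) ∧_) (allᵇ-map q f xs)

allᵇ-filter : ∀ (q p : A → Bool) xs → allᵇ q (filterᵇ p xs) ≡ allᵇ (λ x → not (p x) ∨ q x) xs
allᵇ-filter q p [] = refl
allᵇ-filter q p (x ∷ xs) with p x
... | true  = cong (q x ∧_) (allᵇ-filter q p xs)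
... | false = allᵇ-filter q p xs

allᵇ-cong : ∀ {q r : A → Bool} xs → (∀ x → q x ≡ r x) → allᵇ q xs ≡ allᵇ r xs
allᵇ-cong [] _ = refl
allᵇ-cong (x ∷ xs) q≗r = cong₂ _∧_ (q≗r x) (allᵇ-cong xs q≗r)

allᵇ-allFin-suc : ∀ {n} (q : Fin (suc n) → Bool) → allᵇ q (allFin (suc n)) ≡ q fzero ∧ allᵇ (q ∘ fsuc) (allFin n)
allᵇ-allFin-suc {n} q = cong (q fzero ∧_) (trans (cong (allᵇ q) (sym (map-tabulate id fsuc))) (allᵇ-map q fsuc (allFin n)))

interval-∷ʳ : ∀ s a → interval s (suc a) ≡ interval s a ∷ʳ (s + suc a)
interval-∷ʳ s zero = cong [_] (sym (ℕ.+-comm s 1))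
interval-∷ʳ s (suc a) = cong (suc s ∷_) (trans (interval-∷ʳ (suc s) a) (cong (interval (suc s) a ∷ʳ_) (sym (ℕ.+-suc s (suc a)))))

interval-++ : ∀ s a b → interval s a ++ interval (s + a) b ≡ interval s (a + b)
interval-++ s zero b = cong (λ z → interval z b) (ℕ.+-identityʳ s)
interval-++ s (suc a) b =
  cong (suc s ∷_) (trans (cong (λ z → interval (suc s) a ++ interval z b) (ℕ.+-suc s a)) (interval-++ (suc s) a b))

∈-interval⁻ : ∀ {y} s a → y ∈ interval s a → s < y × y ≤ s + a
∈-interval⁻ s (suc a) (here refl) = ℕ.≤-refl , ℕ.≤-trans (s≤s (ℕ.m≤m+n s a)) (ℕ.≤-reflexive (sym (ℕ.+-suc s a)))
∈-interval⁻ s (suc a) (there y∈) with ∈-interval⁻ (suc s) a y∈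
... | s<y , y≤ = ℕ.<-trans (ℕ.n<1+n s) s<y , ℕ.≤-trans y≤ (ℕ.≤-reflexive (sym (ℕ.+-suc s a)))

∈-interval⁺ : ∀ {y} s a → s < y → y ≤ s + a → y ∈ interval s a
∈-interval⁺ {y} s zero s<y y≤s+0 =
  ⊥-elim (ℕ.<-irrefl refl (ℕ.<-≤-trans s<y (ℕ.≤-trans y≤s+0 (ℕ.≤-reflexive (ℕ.+-identityʳ s)))))
∈-interval⁺ {y} s (suc a) s<y y≤ with y ℕ.≟ suc s
... | yes refl = here refl
... | no y≢ = there (∈-interval⁺ (suc s) a (ℕ.≤∧≢⇒< s<y (y≢ ∘ sym)) (ℕ.≤-trans y≤ (ℕ.≤-reflexive (ℕ.+-suc s a))))

∈-interval-suc⁻ : ∀ {y} s a → y ∈ interval s (suc a) → y ∈ interval s a ⊎ y ≡ s + suc a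
∈-interval-suc⁻ s a y∈ with ∈-++⁻ (interval s a) (subst (_ ∈_) (interval-∷ʳ s a) y∈)
... | inj₁ y∈I = inj₁ y∈I
... | inj₂ (here refl) = inj₂ refl

∈-interval-sucˡ : ∀ {y} s a → y ∈ interval s a → y ∈ interval s (suc a)
∈-interval-sucˡ s a y∈ = subst (_ ∈_) (sym (interval-∷ʳ s a)) (∈-++⁺ˡ y∈)

∈-interval-sucʳ : ∀ s a → s + suc a ∈ interval s (suc a)
∈-interval-sucʳ s a = subst (s + suc a ∈_) (sym (interval-∷ʳ s a)) (∈-++⁺ʳ (interval s a) (here refl))

interval-last∉ : ∀ s a → s + suc a ∉ interval s a
interval-last∉ s a t∈ = ℕ.<-irrefl refl (ℕ.≤-<-trans (proj₂ (∈-interval⁻ s a t∈)) (ℕ.+-monoʳ-< s (ℕ.n<1+n a)))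

last≢first : ∀ s a → s + suc (suc a) ≢ suc s
last≢first s a eq = ℕ.<-irrefl (sym eq) (ℕ.<-≤-trans (ℕ.n<1+n (suc s))
  (ℕ.≤-trans (s≤s (s≤s (ℕ.m≤m+n s a))) (ℕ.≤-reflexive (sym (trans (ℕ.+-suc s (suc a)) (cong suc (ℕ.+-suc s a)))))))

length-interval : ∀ s a → length (interval s a) ≡ a
length-interval s zero = refl
length-interval s (suc a) = cong suc (length-interval (suc s) a)

interval-disjoint : ∀ s a b → Disjoint (interval s a) (interval (s + a) b)
interval-disjoint s a b (y∈ , y∈′) =
  ℕ.<-irrefl refl (ℕ.<-≤-trans (proj₁ (∈-interval⁻ (s + a) b y∈′)) (proj₂ (∈-interval⁻ s a y∈)))

Unique-interval : ∀ s a → Unique (interval s a)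
Unique-interval s zero = []
Unique-interval s (suc a) = All.tabulate (λ y∈ → ℕ.<⇒≢ (proj₁ (∈-interval⁻ (suc s) a y∈))) ∷ Unique-interval (suc s) a

-- Precedence constraints

-- respects (x , y) v: in v, the letter x comes before y whenever both occur.
respects : ℕ × ℕ → List ℕ → Bool
respects (x , y) [] = true
respects (x , y) (z ∷ zs) =
  if x ≡ᵇ z then true else if y ≡ᵇ z then not (memℕ x zs) else respects (x , y) zs

respectsAll : List (ℕ × ℕ) → List ℕ → Bool
respectsAll C v = allᵇ (λ c → respects c v) C

-- Backward C S T: some constraint of C wants a letter of T before a letter of S.
Backward : List (ℕ × ℕ) → List ℕ → List ℕ → Set
Backward C S T = Any (λ c → proj₂ c ∈ S × proj₁ c ∈ T) C

backward : List (ℕ × ℕ) → List ℕ → List ℕ → Bool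
backward C S T = anyᵇ (λ c → memℕ (proj₂ c) S ∧ memℕ (proj₁ c) T) C

backward-reflects : ∀ C S T → Reflects (Backward C S T) (backward C S T)
backward-reflects C S T = anyᵇ-reflects (λ c → memℕ-reflects (proj₂ c) S ×-reflects memℕ-reflects (proj₁ c) T) C

backward-resp-↭ : ∀ C {S S′ T T′} → S ↭ S′ → T ↭ T′ → backward C S T ≡ backward C S′ T′
backward-resp-↭ C {S} {S′} {T} {T′} S↭S′ T↭T′ =
  reflects-≡ (backward-reflects C S T) (backward-reflects C S′ T′)
    (Any.map (λ (y∈ , x∈) → ∈-resp-↭ S↭S′ y∈ , ∈-resp-↭ T↭T′ x∈))
    (Any.map (λ (y∈ , x∈) → ∈-resp-↭ (↭-sym S↭S′) y∈ , ∈-resp-↭ (↭-sym T↭T′) x∈))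

backward⇒∃ : ∀ C S T → backward C S T ≡ true → ∃₂ λ x y → (x , y) ∈ C × y ∈ S × x ∈ T
backward⇒∃ C S T bk with find (reflects-witness (backward-reflects C S T) bk)
... | (x , y) , c∈C , y∈S , x∈T = x , y , c∈C , y∈S , x∈T

∄⇒¬backward : ∀ C S T → (∀ {x y} → (x , y) ∈ C → y ∈ S → x ∈ T → ⊥) → backward C S T ≡ false
∄⇒¬backward C S T ∄ = reflects-false (backward-reflects C S T) λ bk →
  let (x , y) , c∈C , y∈S , x∈T = find bk in ∄ c∈C y∈S x∈T

¬backward⇒∄ : ∀ C S T → backward C S T ≡ false → ∀ {x y} → (x , y) ∈ C → y ∈ S → x ∈ T → ⊥
¬backward⇒∄ C S T ¬bk xy∈C y∈S x∈T
  with () ← trans (sym ¬bk) (reflects-true (backward-reflects C S T) (lose xy∈C (y∈S , x∈T)))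

Disjoint-resp-↭ : ∀ {S T v v′ : List ℕ} → v ↭ S → v′ ↭ T → Disjoint S T → Disjoint v v′
Disjoint-resp-↭ v↭S v′↭T S#T (z∈v , z∈v′) = S#T (∈-resp-↭ v↭S z∈v , ∈-resp-↭ v′↭T z∈v′)

respects-absent : ∀ x y v → x ∉ v ⊎ y ∉ v → respects (x , y) v ≡ true
respects-absent x y [] _ = refl
respects-absent x y (z ∷ zs) x∉⊎y∉ with x ≡ᵇ z | ≡ᵇ-reflects x z | y ≡ᵇ z | ≡ᵇ-reflects y z
... | true  | ofʸ refl | _     | _        = refl
... | false | ofⁿ _    | true  | ofʸ refl with x∉⊎y∉
...   | inj₁ x∉ = cong not (∉⇒memℕ (x∉ ∘ there))
...   | inj₂ y∉ = ⊥-elim (y∉ (here refl))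
respects-absent x y (z ∷ zs) x∉⊎y∉ | false | ofⁿ _ | false | ofⁿ _ =
  respects-absent x y zs (⊎-map (_∘ there) (_∘ there) x∉⊎y∉)

respects-[_] : ∀ z c → respects c [ z ] ≡ true
respects-[ z ] (x , y) with x ≡ᵇ z | y ≡ᵇ z
... | true  | _     = refl
... | false | true  = refl
... | false | false = refl

respects-++ : ∀ x y v v′ → Disjoint v v′ →
  respects (x , y) (v ++ v′) ≡ respects (x , y) v ∧ (respects (x , y) v′ ∧ not (memℕ y v ∧ memℕ x v′))
respects-++ x y [] v′ _ = sym (∧-identityʳ _)
respects-++ x y (z ∷ zs) v′ v#v′ with x ≡ᵇ z | ≡ᵇ-reflects x z | y ≡ᵇ z | ≡ᵇ-reflects y z
... | true | ofʸ refl | _ | _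
  rewrite respects-absent x y v′ (inj₁ (λ x∈ → v#v′ (here refl , x∈)))
        | ∉⇒memℕ (λ x∈ → v#v′ (here {xs = zs} refl , x∈))
  = sym (cong not (∧-zeroʳ _))
... | false | ofⁿ _ | true | ofʸ refl
  rewrite respects-absent x y v′ (inj₂ (λ y∈ → v#v′ (here refl , y∈))) | memℕ-++ x zs v′
  = deMorgan₂ (memℕ x zs) (memℕ x v′)
... | false | ofⁿ _ | false | ofⁿ _ = respects-++ x y zs v′ (λ (z∈ , z∈′) → v#v′ (there z∈ , z∈′))

respectsAll-[_] : ∀ z C → respectsAll C [ z ] ≡ true
respectsAll-[ z ] = allᵇ-true (respects-[ z ])

respectsAll-++ : ∀ C v v′ → Disjoint v v′ →
  respectsAll C (v ++ v′) ≡ respectsAll C v ∧ (respectsAll C v′ ∧ not (backward C v v′))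
respectsAll-++ [] v v′ _ = refl
respectsAll-++ ((x , y) ∷ C) v v′ v#v′
  rewrite respects-++ x y v v′ v#v′ | respectsAll-++ C v v′ v#v′ =
  shuffle (respects (x , y) v) (respects (x , y) v′) (memℕ y v ∧ memℕ x v′) (respectsAll C v) (respectsAll C v′) (backward C v v′)
  where
  shuffle : ∀ a b c d e f → (a ∧ (b ∧ not c)) ∧ (d ∧ (e ∧ not f)) ≡ (a ∧ d) ∧ ((b ∧ e) ∧ not (c ∨ f))
  shuffle true true false d e f = refl
  shuffle true true true d e f = sym (trans (cong (d ∧_) (∧-zeroʳ e)) (∧-zeroʳ d))
  shuffle true false c d e f = sym (∧-zeroʳ d)
  shuffle false b c d e f = refl

Chained : List (ℕ × ℕ) → ℕ → ℕ → Set
Chained C s a = ∀ {y} → y ∈ interval s a → y ≢ suc s → ∃ λ x → (x , y) ∈ C × x ≢ y × x ∈ interval s a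

AscendingOn : List (ℕ × ℕ) → List ℕ → Set
AscendingOn C S = ∀ {x y} → (x , y) ∈ C → x ∈ S → y ∈ S → x ≤ y

DescentOn : List (ℕ × ℕ) → List ℕ → Set
DescentOn C S = ∃₂ λ x y → (x , y) ∈ C × x ∈ S × y ∈ S × y < x

TwoColoured : (ℕ → ℕ) → List ℕ → Set
TwoColoured κ S = ∃₂ λ x y → x ∈ S × y ∈ S × κ x ≢ κ y

TwoColoured-interval-suc : ∀ {κ s a z} → TwoColoured κ (interval s (suc a)) →
  z ∈ interval s a → κ z ≡ κ (s + suc a) → TwoColoured κ (interval s a)
TwoColoured-interval-suc {κ} {s} {a} {z} (x , y , x∈ , y∈ , κx≢κy) z∈ κz≡κt =
  let x′ , x′∈ , κx′≡κx = retract x∈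
      y′ , y′∈ , κy′≡κy = retract y∈
  in x′ , y′ , x′∈ , y′∈ , λ κx′≡κy′ → κx≢κy (trans (sym κx′≡κx) (trans κx′≡κy′ κy′≡κy))
  where
  retract : ∀ {v} → v ∈ interval s (suc a) → ∃ λ v′ → v′ ∈ interval s a × κ v′ ≡ κ v
  retract v∈ with ∈-interval-suc⁻ s a v∈
  ... | inj₁ v∈I = _ , v∈I , refl
  ... | inj₂ refl = z , z∈ , κz≡κt

Chained⇒backward : ∀ {C s a} → Chained C s (suc (suc a)) →
  backward C [ s + suc (suc a) ] (interval s (suc a)) ≡ true
Chained⇒backward {C} {s} {a} ch with ch (∈-interval-sucʳ s (suc a)) (last≢first s a)
... | x , xt∈C , x≢t , x∈ with ∈-interval-suc⁻ s (suc a) x∈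
...   | inj₁ x∈I = reflects-true (backward-reflects C [ s + suc (suc a) ] (interval s (suc a))) (lose xt∈C (here refl , x∈I))
...   | inj₂ x≡t = ⊥-elim (x≢t x≡t)

Chained-suc : ∀ {C s a} → Chained C s (suc (suc a)) →
  backward C (interval s (suc a)) [ s + suc (suc a) ] ≡ false → Chained C s (suc a)
Chained-suc {C} {s} {a} ch ¬bk y∈ y≢ with ch (∈-interval-sucˡ s (suc a) y∈) y≢
... | x , xy∈C , x≢y , x∈ with ∈-interval-suc⁻ s (suc a) x∈
...   | inj₁ x∈I = x , xy∈C , x≢y , x∈I
...   | inj₂ refl = ⊥-elim (¬backward⇒∄ C (interval s (suc a)) [ s + suc (suc a) ] ¬bk xy∈C y∈ (here refl))

allᵇ-desFrom-tabulate : ∀ (P : ℕ → Bool) m k (f : Fin (suc m) → ℕ) →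
  allᵇ P (desFrom k (tabulate f)) ≡ allᵇ (λ i → not (f (fsuc i) <ᵇ f (inject₁ i)) ∨ P (k + toℕ i)) (allFin m)
allᵇ-desFrom-tabulate P zero k f = refl
allᵇ-desFrom-tabulate P (suc m) k f =
  trans (allᵇ-++ P (if f (fsuc fzero) <ᵇ f fzero then k ∷ [] else []) (desFrom (suc k) (tabulate (f ∘ fsuc))))
  (trans (cong₂ _∧_ (first-descent (f (fsuc fzero) <ᵇ f fzero))
                    (trans (allᵇ-desFrom-tabulate P m (suc k) (f ∘ fsuc)) (allᵇ-cong (allFin m) shift)))
         (sym (allᵇ-allFin-suc (λ i → not (f (fsuc i) <ᵇ f (inject₁ i)) ∨ P (k + toℕ i)))))
  where
  first-descent : ∀ b → allᵇ P (if b then k ∷ [] else []) ≡ not b ∨ P (k + 0)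
  first-descent true = trans (∧-identityʳ (P k)) (cong P (sym (ℕ.+-identityʳ k)))
  first-descent false = refl
  shift : ∀ i → (not (f (fsuc (fsuc i)) <ᵇ f (fsuc (inject₁ i))) ∨ P (suc k + toℕ i)) ≡
                (not (f (fsuc (fsuc i)) <ᵇ f (fsuc (inject₁ i))) ∨ P (k + suc (toℕ i)))
  shift i = cong (λ j → not (f (fsuc (fsuc i)) <ᵇ f (fsuc (inject₁ i))) ∨ P j) (sym (ℕ.+-suc k (toℕ i)))

Des⊆-allFin : ∀ PS m (σ : Fin (suc m) → Fin (suc m)) → allᵇ (λ d → memℕ d PS) (Des σ) ≡
  allᵇ (λ i → not (toℕ (σ (fsuc i)) <ᵇ toℕ (σ (inject₁ i))) ∨ memℕ (suc (toℕ i)) PS) (allFin m)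
Des⊆-allFin PS m σ = trans (cong (allᵇ (λ d → memℕ d PS) ∘ desFrom 1) (map-tabulate id (λ i → suc (toℕ (σ i)))))
                          (allᵇ-desFrom-tabulate (λ d → memℕ d PS) m 1 (λ i → suc (toℕ (σ i))))

constraints : ∀ {m} → List ℕ → (Fin (suc m) → ℕ) → List (ℕ × ℕ)
constraints {m} PS ℓ = map (λ i → ℓ (inject₁ i) , ℓ (fsuc i)) (filterᵇ (λ i → not (memℕ (suc (toℕ i)) PS)) (allFin m))

respectsAll-constraints : ∀ {m} PS (ℓ : Fin (suc m) → ℕ) v → respectsAll (constraints PS ℓ) v ≡
  allᵇ (λ i → memℕ (suc (toℕ i)) PS ∨ respects (ℓ (inject₁ i) , ℓ (fsuc i)) v) (allFin m)
respectsAll-constraints {m} PS ℓ v =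
  trans (allᵇ-map (λ c → respects c v) (λ i → ℓ (inject₁ i) , ℓ (fsuc i)) (filterᵇ (λ i → not (memℕ (suc (toℕ i)) PS)) (allFin m)))
  (trans (allᵇ-filter (λ i → respects (ℓ (inject₁ i) , ℓ (fsuc i)) v) (λ i → not (memℕ (suc (toℕ i)) PS)) (allFin m))
         (allᵇ-cong (allFin m) (λ i → cong (_∨ respects (ℓ (inject₁ i) , ℓ (fsuc i)) v) (not-involutive (memℕ (suc (toℕ i)) PS)))))

injectiveᵇ-intro : ∀ {n} (σ : Fin n → Fin n) → (∀ {i j} → σ i ≡ σ j → i ≡ j) → injectiveᵇ σ ≡ true
injectiveᵇ-intro {n} σ σ-inj = allᵇ-true (λ i → allᵇ-true (pair i) (allFin n)) (allFin n)
  where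
  pair : ∀ i j → ((toℕ i ≡ᵇ toℕ j) ∨ not (toℕ (σ i) ≡ᵇ toℕ (σ j))) ≡ true
  pair i j with toℕ i ≡ᵇ toℕ j | ≡ᵇ-reflects (toℕ i) (toℕ j)
  ... | true  | _ = refl
  ... | false | ofⁿ i≢j with toℕ (σ i) ≡ᵇ toℕ (σ j) | ≡ᵇ-reflects (toℕ (σ i)) (toℕ (σ j))
  ...   | true  | ofʸ eq = ⊥-elim (i≢j (cong toℕ (σ-inj (Fin.toℕ-injective eq))))
  ...   | false | _ = refl

⟨$⟩ʳ-injective : ∀ {n} (π : Permutation′ n) {i j} → π ⟨$⟩ʳ i ≡ π ⟨$⟩ʳ j → i ≡ j
⟨$⟩ʳ-injective π {i} {j} eq = trans (sym (inverseˡ π)) (trans (cong (π ⟨$⟩ˡ_) eq) (inverseˡ π))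

⟨$⟩ˡ-injective : ∀ {n} (π : Permutation′ n) {i j} → π ⟨$⟩ˡ i ≡ π ⟨$⟩ˡ j → i ≡ j
⟨$⟩ˡ-injective π {i} {j} eq = trans (sym (inverseʳ π)) (trans (cong (π ⟨$⟩ʳ_) eq) (inverseʳ π))

inject₁≢fsuc : ∀ {k} (i : Fin k) → inject₁ i ≢ fsuc i
inject₁≢fsuc i eq = ℕ.<-irrefl (trans (sym (Fin.toℕ-inject₁ i)) (cong toℕ eq)) ℕ.≤-refl

-- (v · σ) · u is the word of w exactly when v (σ j) = letterAt u w j for all j.
letterAt : ∀ {n} → Permutation′ n → Permutation′ n → Fin n → ℕ
letterAt u w j = suc (toℕ (w ⟨$⟩ʳ (u ⟨$⟩ˡ j)))

letterAt-injective : ∀ {n} (u w : Permutation′ n) {i j} → letterAt u w i ≡ letterAt u w j → i ≡ j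
letterAt-injective u w eq = ⟨$⟩ˡ-injective u (⟨$⟩ʳ-injective w (Fin.toℕ-injective (ℕ.suc-injective eq)))

indexOf : ℕ → List ℕ → ℕ
indexOf x [] = 0
indexOf x (z ∷ zs) = if x ≡ᵇ z then 0 else suc (indexOf x zs)

respects-indexOf : ∀ {x y v} → Unique v → x ∈ v → y ∈ v → x ≢ y → respects (x , y) v ≡ (indexOf x v <ᵇ indexOf y v)
respects-indexOf {x} {y} {z ∷ zs} (z∉zs ∷ uniq) x∈ y∈ x≢y
  with x ≡ᵇ z | ≡ᵇ-reflects x z | y ≡ᵇ z | ≡ᵇ-reflects y z
... | true  | ofʸ refl | true  | ofʸ refl = ⊥-elim (x≢y refl)
... | true  | ofʸ refl | false | _        = refl
... | false | ofⁿ x≢z  | true  | ofʸ refl = cong not (∈⇒memℕ (Any.tail x≢z x∈))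
... | false | ofⁿ x≢z  | false | ofⁿ y≢z  = respects-indexOf uniq (Any.tail x≢z x∈) (Any.tail y≢z y∈) x≢y

not-<ᵇ : ∀ {a b} → a ≢ b → not (b <ᵇ a) ≡ (a <ᵇ b)
not-<ᵇ {a} {b} a≢b with b <ᵇ a | ℕ.<ᵇ-reflects-< b a | a <ᵇ b | ℕ.<ᵇ-reflects-< a b
... | true  | ofʸ b<a | true  | ofʸ a<b = ⊥-elim (ℕ.<-asym a<b b<a)
... | true  | _       | false | _       = refl
... | false | _       | true  | _       = refl
... | false | ofⁿ b≮a | false | ofⁿ a≮b = ⊥-elim (a≢b (ℕ.≤-antisym (ℕ.≮⇒≥ b≮a) (ℕ.≮⇒≥ a≮b)))

-- Compositions and their blocks

-- Block s α t b: the interval (t, t + b] is one of the blocks of Sets α shifted by s.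
Block : ℕ → List ℕ → ℕ → ℕ → Set
Block s [] t b = ⊥
Block s (a ∷ α) t b = (t ≡ s × b ≡ a) ⊎ Block (s + a) α t b

Increasing : ℕ → List ℕ → ℕ → Set
Increasing prev [] n = prev < n
Increasing prev (i ∷ is) n = prev < i × Increasing i is n

Increasing⇒< : ∀ {prev I n} → Increasing prev I n → prev < n
Increasing⇒< {I = []} prev<n = prev<n
Increasing⇒< {I = i ∷ is} (prev<i , inc) = ℕ.<-trans prev<i (Increasing⇒< inc)

Increasing-∈ : ∀ {prev I n c} → Increasing prev I n → c ∈ I → prev < c × c < n
Increasing-∈ (prev<i , inc) (here refl) = prev<i , Increasing⇒< inc
Increasing-∈ (prev<i , inc) (there c∈) with Increasing-∈ inc c∈
... | i<c , c<n = ℕ.<-trans prev<i i<c , c<n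

AllPairs⇒Increasing : ∀ {prev n I} → AllPairs _<_ I → All (λ c → prev < c × c < n) I → prev < n → Increasing prev I n
AllPairs⇒Increasing [] [] prev<n = prev<n
AllPairs⇒Increasing (i<is ∷ sorted) ((prev<i , i<n) ∷ bounds) _ =
  prev<i , AllPairs⇒Increasing sorted (All.zipWith (λ (i<c , (_ , c<n)) → i<c , c<n) (i<is , bounds)) i<n

+-sumℕ-compDiffs : ∀ n prev I → Increasing prev I n → prev + sumℕ (compDiffs n prev I) ≡ n
+-sumℕ-compDiffs n prev [] prev<n = trans (cong (prev +_) (ℕ.+-identityʳ (n ∸ prev))) (ℕ.m+[n∸m]≡n (ℕ.<⇒≤ prev<n))
+-sumℕ-compDiffs n prev (i ∷ is) (prev<i , inc) =
  trans (sym (ℕ.+-assoc prev (i ∸ prev) _))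
        (trans (cong (_+ sumℕ (compDiffs n i is)) (ℕ.m+[n∸m]≡n (ℕ.<⇒≤ prev<i))) (+-sumℕ-compDiffs n i is inc))

partialSumsFrom-compDiffs : ∀ n prev I → Increasing prev I n → partialSumsFrom prev (compDiffs n prev I) ≡ I
partialSumsFrom-compDiffs n prev [] _ = refl
partialSumsFrom-compDiffs n prev (i ∷ []) (prev<i , _) = cong (_∷ []) (ℕ.m+[n∸m]≡n (ℕ.<⇒≤ prev<i))
partialSumsFrom-compDiffs n prev (i ∷ j ∷ is) (prev<i , inc) =
  trans (cong (λ a → a ∷ partialSumsFrom a (compDiffs n i (j ∷ is))) (ℕ.m+[n∸m]≡n (ℕ.<⇒≤ prev<i)))
        (cong (i ∷_) (partialSumsFrom-compDiffs n i (j ∷ is) inc))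

-- prev < i₁ < ⋯ < iₖ < n cut [prev, n) into blocks;
-- x lies in the block [blockStart prev I x, blockEnd I n x).
blockStart : ℕ → List ℕ → ℕ → ℕ
blockStart prev [] x = prev
blockStart prev (i ∷ is) x = if x <ᵇ i then prev else blockStart i is x

blockEnd : List ℕ → ℕ → ℕ → ℕ
blockEnd [] n x = n
blockEnd (i ∷ is) n x = if x <ᵇ i then i else blockEnd is n x

blockStart-∈ : ∀ prev I x → blockStart prev I x ∈ prev ∷ I
blockStart-∈ prev [] x = here refl
blockStart-∈ prev (i ∷ is) x with x <ᵇ i
... | true  = here refl
... | false = there (blockStart-∈ i is x)

blockStart-≤ : ∀ {prev I n} x → Increasing prev I n → prev ≤ x → blockStart prev I x ≤ x
blockStart-≤ {I = []} x _ prev≤x = prev≤x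
blockStart-≤ {I = i ∷ is} x (_ , inc) prev≤x with x <ᵇ i | ℕ.<ᵇ-reflects-< x i
... | true  | _ = prev≤x
... | false | ofⁿ x≮i = blockStart-≤ x inc (ℕ.≮⇒≥ x≮i)

≤-blockStart : ∀ {prev I n} x → Increasing prev I n → prev ≤ blockStart prev I x
≤-blockStart {prev} {I} x inc with blockStart-∈ prev I x
... | here eq = ℕ.≤-reflexive (sym eq)
... | there s∈ = ℕ.<⇒≤ (proj₁ (Increasing-∈ inc s∈))

blockStart-maximal : ∀ {prev I n c} x → Increasing prev I n → prev ≤ x → c ∈ prev ∷ I → c ≤ x → c ≤ blockStart prev I x
blockStart-maximal x inc _ (here refl) _ = ≤-blockStart x inc
blockStart-maximal {I = i ∷ is} x (_ , inc) _ (there c∈) c≤x with x <ᵇ i | ℕ.<ᵇ-reflects-< x i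
... | true | ofʸ x<i = ⊥-elim (ℕ.<-irrefl refl (ℕ.<-≤-trans x<i (ℕ.≤-trans (i≤ c∈) c≤x)))
  where
  i≤ : ∀ {c} → c ∈ i ∷ is → i ≤ c
  i≤ (here refl) = ℕ.≤-refl
  i≤ (there c∈) = ℕ.<⇒≤ (proj₁ (Increasing-∈ inc c∈))
... | false | ofⁿ x≮i = blockStart-maximal x inc (ℕ.≮⇒≥ x≮i) c∈ c≤x

blockEnd-∈ : ∀ I n x → blockEnd I n x ∈ I ⊎ blockEnd I n x ≡ n
blockEnd-∈ [] n x = inj₂ refl
blockEnd-∈ (i ∷ is) n x with x <ᵇ i
... | true = inj₁ (here refl)
... | false with blockEnd-∈ is n x
...   | inj₁ e∈ = inj₁ (there e∈)
...   | inj₂ e≡n = inj₂ e≡n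

<-blockEnd : ∀ {prev I n} x → Increasing prev I n → x < n → x < blockEnd I n x
<-blockEnd {I = []} x _ x<n = x<n
<-blockEnd {I = i ∷ is} x (_ , inc) x<n with x <ᵇ i | ℕ.<ᵇ-reflects-< x i
... | true  | ofʸ x<i = x<i
... | false | _ = <-blockEnd x inc x<n

blockEnd-minimal : ∀ {prev I n c} x → Increasing prev I n → c ∈ I → x < c → blockEnd I n x ≤ c
blockEnd-minimal {I = i ∷ is} x (_ , inc) c∈ x<c with x <ᵇ i | ℕ.<ᵇ-reflects-< x i | c∈
... | true  | _        | here refl = ℕ.≤-refl
... | true  | _        | there c∈′ = ℕ.<⇒≤ (proj₁ (Increasing-∈ inc c∈′))
... | false | ofⁿ x≮i  | here refl = ⊥-elim (x≮i x<c)
... | false | _        | there c∈′ = blockEnd-minimal x inc c∈′ x<c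

blockEnd-≤ : ∀ {prev I n} x → Increasing prev I n → blockEnd I n x ≤ n
blockEnd-≤ {I = I} {n} x inc with blockEnd-∈ I n x
... | inj₁ e∈ = ℕ.<⇒≤ (proj₂ (Increasing-∈ inc e∈))
... | inj₂ e≡n = ℕ.≤-reflexive e≡n

Block-blockStart : ∀ n prev I x → Increasing prev I n → prev ≤ x →
  Block prev (compDiffs n prev I) (blockStart prev I x) (blockEnd I n x ∸ blockStart prev I x)
Block-blockStart n prev [] x _ _ = inj₁ (refl , refl)
Block-blockStart n prev (i ∷ is) x (prev<i , inc) _ with x <ᵇ i | ℕ.<ᵇ-reflects-< x i
... | true  | _ = inj₁ (refl , refl)
... | false | ofⁿ x≮i =
  inj₂ (subst (λ s → Block s (compDiffs n i is) (blockStart i is x) (blockEnd is n x ∸ blockStart i is x))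
              (sym (ℕ.m+[n∸m]≡n (ℕ.<⇒≤ prev<i))) (Block-blockStart n i is x inc (ℕ.≮⇒≥ x≮i)))

Block-compDiffs⇒ : ∀ n prev I {s a} → Increasing prev I n → Block prev (compDiffs n prev I) s a →
  prev ≤ s × s + a ≤ n × (∀ z → s ≤ z → z < s + a → blockStart prev I z ≡ s)
Block-compDiffs⇒ n prev [] prev<n (inj₁ (refl , refl)) =
  ℕ.≤-refl , ℕ.≤-reflexive (ℕ.m+[n∸m]≡n (ℕ.<⇒≤ prev<n)) , λ _ _ _ → refl
Block-compDiffs⇒ n prev (i ∷ is) (prev<i , inc) (inj₁ (refl , refl)) =
  ℕ.≤-refl , ℕ.≤-trans (ℕ.≤-reflexive prev+i∸prev≡i) (ℕ.<⇒≤ (Increasing⇒< inc)) , same-start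
  where
  prev+i∸prev≡i = ℕ.m+[n∸m]≡n (ℕ.<⇒≤ prev<i)
  same-start : ∀ z → prev ≤ z → z < prev + (i ∸ prev) → blockStart prev (i ∷ is) z ≡ prev
  same-start z _ z< with z <ᵇ i | ℕ.<ᵇ-reflects-< z i
  ... | true  | _ = refl
  ... | false | ofⁿ z≮i = ⊥-elim (z≮i (subst (z <_) prev+i∸prev≡i z<))
Block-compDiffs⇒ n prev (i ∷ is) {s} {a} (prev<i , inc) (inj₂ blk)
  with Block-compDiffs⇒ n i is inc (subst (λ t → Block t (compDiffs n i is) s a) (ℕ.m+[n∸m]≡n (ℕ.<⇒≤ prev<i)) blk)
... | i≤s , s+a≤n , same-start = ℕ.≤-trans (ℕ.<⇒≤ prev<i) i≤s , s+a≤n , same-start′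
  where
  same-start′ : ∀ z → s ≤ z → z < s + a → blockStart prev (i ∷ is) z ≡ s
  same-start′ z s≤z z< with z <ᵇ i | ℕ.<ᵇ-reflects-< z i
  ... | true  | ofʸ z<i = ⊥-elim (ℕ.<-irrefl refl (ℕ.<-≤-trans z<i (ℕ.≤-trans i≤s s≤z)))
  ... | false | _ = same-start z s≤z z<

module Blocks {n I} (inc : Increasing 0 I n) where

  st : ℕ → ℕ
  st = blockStart 0 I

  en : ℕ → ℕ
  en = blockEnd I n

  st-≤ : ∀ x → st x ≤ x
  st-≤ x = blockStart-≤ x inc z≤n

  st-∈ : ∀ x → st x ∈ 0 ∷ I
  st-∈ = blockStart-∈ 0 I

  st-maximal : ∀ x {c} → c ∈ 0 ∷ I → c ≤ x → c ≤ st x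
  st-maximal x = blockStart-maximal x inc z≤n

  st-fixed : ∀ {c} → c ∈ 0 ∷ I → st c ≡ c
  st-fixed {c} c∈ = ℕ.≤-antisym (st-≤ c) (st-maximal c c∈ ℕ.≤-refl)

  <-en : ∀ x → x < n → x < en x
  <-en x = <-blockEnd x inc

  en-≤ : ∀ x → en x ≤ n
  en-≤ x = blockEnd-≤ x inc

  st≤en : ∀ x → x < n → st x ≤ en x
  st≤en x x<n = ℕ.<⇒≤ (ℕ.≤-<-trans (st-≤ x) (<-en x x<n))

  st-≡ : ∀ x y → st x ≤ y → y < en x → st y ≡ st x
  st-≡ x y st≤y y<en = ℕ.≤-antisym (st-y≤ (ℕ.≤-<-connex (st y) x) (st-∈ y)) (st-maximal y (st-∈ x) st≤y)
    where
    st-y≤ : st y ≤ x ⊎ x < st y → st y ∈ 0 ∷ I → st y ≤ st x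
    st-y≤ (inj₁ sty≤x) s∈ = st-maximal x s∈ sty≤x
    st-y≤ (inj₂ x<sty) (here sty≡0) = ⊥-elim (ℕ.<-irrefl refl (ℕ.<-≤-trans x<sty (ℕ.≤-trans (ℕ.≤-reflexive sty≡0) z≤n)))
    st-y≤ (inj₂ x<sty) (there s∈) =
      ⊥-elim (ℕ.<-irrefl refl (ℕ.<-≤-trans y<en (ℕ.≤-trans (blockEnd-minimal x inc s∈ x<sty) (st-≤ y))))

  <-en-of-st-≡ : ∀ x y → x < n → y < n → st y ≡ st x → y < en x
  <-en-of-st-≡ x y x<n y<n sty≡stx with ℕ.<-≤-connex y (en x) | blockEnd-∈ I n x
  ... | inj₁ y<en | _ = y<en
  ... | inj₂ en≤y | inj₂ en≡n = ⊥-elim (ℕ.<-irrefl refl (ℕ.<-≤-trans y<n (ℕ.≤-trans (ℕ.≤-reflexive (sym en≡n)) en≤y)))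
  ... | inj₂ en≤y | inj₁ en∈ = ⊥-elim (ℕ.<-irrefl refl (ℕ.≤-<-trans
          (ℕ.≤-trans (st-maximal y (there en∈) en≤y) (ℕ.≤-trans (ℕ.≤-reflexive sty≡stx) (st-≤ x))) (<-en x x<n)))

  st-suc : ∀ c → suc c ∉ I → st (suc c) ≡ st c
  st-suc c sc∉I = ℕ.≤-antisym st-sc≤ (st-maximal (suc c) (st-∈ c) (ℕ.≤-trans (st-≤ c) (ℕ.n≤1+n c)))
    where
    st-sc≤ : st (suc c) ≤ st c
    st-sc≤ with st-∈ (suc c) | ℕ.m≤n⇒m<n∨m≡n (st-≤ (suc c))
    ... | s∈ | inj₁ (s≤s st-sc≤c) = st-maximal c s∈ st-sc≤c
    ... | here st≡0 | inj₂ st≡sc = ⊥-elim (ℕ.0≢1+n (trans (sym st≡0) st≡sc))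
    ... | there s∈ | inj₂ st≡sc = ⊥-elim (sc∉I (subst (_∈ I) st≡sc s∈))

  Block-st : ∀ x → Block 0 (compDiffs n 0 I) (st x) (en x ∸ st x)
  Block-st x = Block-blockStart n 0 I x inc z≤n

  -- the letters y + 1 for the values y in the block of x
  block : ℕ → List ℕ
  block x = interval (st x) (en x ∸ st x)

  ∈-block⁺ : ∀ {x y} → x < n → y < n → st y ≡ st x → suc y ∈ block x
  ∈-block⁺ {x} {y} x<n y<n sty≡stx = ∈-interval⁺ (st x) (en x ∸ st x)
    (s≤s (ℕ.≤-trans (ℕ.≤-reflexive (sym sty≡stx)) (st-≤ y)))
    (ℕ.≤-trans (<-en-of-st-≡ x y x<n y<n sty≡stx) (ℕ.≤-reflexive (sym (ℕ.m+[n∸m]≡n (st≤en x x<n)))))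

  ∈-block⁻ : ∀ {x z} → x < n → z ∈ block x → ∃ λ y → z ≡ suc y × st y ≡ st x × y < n
  ∈-block⁻ {x} {z} x<n z∈ with ∈-interval⁻ (st x) (en x ∸ st x) z∈
  ... | st<z , z≤ with z
  ...   | suc y = y , refl , st-≡ x y (ℕ.≤-pred st<z) y<en , ℕ.<-≤-trans y<en (en-≤ x)
    where
    y<en : y < en x
    y<en = ℕ.≤-trans z≤ (ℕ.≤-reflexive (ℕ.m+[n∸m]≡n (st≤en x x<n)))

blockIndex : ∀ n prev I → ℕ → Fin (length (compDiffs n prev I))
blockIndex n prev [] x = fzero
blockIndex n prev (i ∷ is) x = if x <ᵇ i then fzero else fsuc (blockIndex n i is x)

δ : ∀ {k} → Fin k → Fin k → ℕ
δ a i = if toℕ a ≡ᵇ toℕ i then 1 else 0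

sumFrom : ℕ → ℕ → (ℕ → ℕ) → ℕ
sumFrom a zero g = 0
sumFrom a (suc k) g = g a + sumFrom (suc a) k g

sumFrom-++ : ∀ a k l g → sumFrom a (k + l) g ≡ sumFrom a k g + sumFrom (a + k) l g
sumFrom-++ a zero l g = cong (λ b → sumFrom b l g) (sym (ℕ.+-identityʳ a))
sumFrom-++ a (suc k) l g =
  trans (cong (g a +_) (trans (sumFrom-++ (suc a) k l g) (cong (λ b → sumFrom (suc a) k g + sumFrom b l g) (sym (ℕ.+-suc a k)))))
        (sym (ℕ.+-assoc (g a) _ _))

sumFrom-cong : ∀ a k {g h : ℕ → ℕ} → (∀ x → a ≤ x → x < a + k → g x ≡ h x) → sumFrom a k g ≡ sumFrom a k h
sumFrom-cong a zero _ = refl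
sumFrom-cong a (suc k) g≗h =
  cong₂ _+_ (g≗h a ℕ.≤-refl (ℕ.m<m+n a (s≤s z≤n)))
            (sumFrom-cong (suc a) k λ x a<x x< → g≗h x (ℕ.<⇒≤ a<x) (ℕ.≤-trans x< (ℕ.≤-reflexive (sym (ℕ.+-suc a k)))))

sumFrom-const : ∀ a k c → sumFrom a k (λ _ → c) ≡ k * c
sumFrom-const a zero c = refl
sumFrom-const a (suc k) c = cong (c +_) (sumFrom-const (suc a) k c)

sumFrom≡sum : ∀ a k g → sumFrom a k g ≡ sum (λ (x : Fin k) → g (a + toℕ x))
sumFrom≡sum a zero g = refl
sumFrom≡sum a (suc k) g = cong₂ _+_ (cong g (sym (ℕ.+-identityʳ a)))
  (trans (sumFrom≡sum (suc a) k g) (sum-cong-≗ {k} (λ x → cong g (sym (ℕ.+-suc a (toℕ x))))))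

∸-split : ∀ {a b c} → a ≤ b → b ≤ c → c ∸ a ≡ (b ∸ a) + (c ∸ b)
∸-split {a} {b} {c} a≤b b≤c = trans (cong (_∸ a) (sym (ℕ.m+[n∸m]≡n b≤c))) (ℕ.+-∸-comm (c ∸ b) a≤b)

blockIndex-< : ∀ n prev i is {x} → x < i → blockIndex n prev (i ∷ is) x ≡ fzero
blockIndex-< n prev i is {x} x<i with x <ᵇ i | ℕ.<ᵇ-reflects-< x i
... | true  | _ = refl
... | false | ofⁿ x≮i = ⊥-elim (x≮i x<i)

blockIndex-≥ : ∀ n prev i is {x} → i ≤ x → blockIndex n prev (i ∷ is) x ≡ fsuc (blockIndex n i is x)
blockIndex-≥ n prev i is {x} i≤x with x <ᵇ i | ℕ.<ᵇ-reflects-< x i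
... | true  | ofʸ x<i = ⊥-elim (ℕ.<-irrefl refl (ℕ.<-≤-trans x<i i≤x))
... | false | _ = refl

blockSize-count : ∀ n prev I → Increasing prev I n → ∀ j →
  sumFrom prev (n ∸ prev) (λ x → δ (blockIndex n prev I x) j) ≡ lookup (compDiffs n prev I) j
blockSize-count n prev [] prev<n fzero = trans (sumFrom-const prev (n ∸ prev) 1) (ℕ.*-identityʳ _)
blockSize-count n prev (i ∷ is) (prev<i , inc) j = begin
  sumFrom prev (n ∸ prev) g
    ≡⟨ cong (λ k → sumFrom prev k g) (∸-split (ℕ.<⇒≤ prev<i) (ℕ.<⇒≤ (Increasing⇒< inc))) ⟩
  sumFrom prev ((i ∸ prev) + (n ∸ i)) g
    ≡⟨ sumFrom-++ prev (i ∸ prev) (n ∸ i) g ⟩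
  sumFrom prev (i ∸ prev) g + sumFrom (prev + (i ∸ prev)) (n ∸ i) g
    ≡⟨ cong (λ a → sumFrom prev (i ∸ prev) g + sumFrom a (n ∸ i) g) prev+i∸prev≡i ⟩
  sumFrom prev (i ∸ prev) g + sumFrom i (n ∸ i) g
    ≡⟨ cong₂ _+_ (sumFrom-cong prev (i ∸ prev) λ x _ x< → cong (λ b → δ b j) (blockIndex-< n prev i is (subst (x <_) prev+i∸prev≡i x<)))
                 (sumFrom-cong i (n ∸ i) λ x i≤x _ → cong (λ b → δ b j) (blockIndex-≥ n prev i is i≤x)) ⟩
  sumFrom prev (i ∸ prev) (λ _ → δ fzero j) + sumFrom i (n ∸ i) (λ x → δ (fsuc (blockIndex n i is x)) j)
    ≡⟨ count j ⟩
  lookup (compDiffs n prev (i ∷ is)) j ∎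
  where
  open ≡-Reasoning
  g : ℕ → ℕ
  g x = δ (blockIndex n prev (i ∷ is) x) j
  prev+i∸prev≡i : prev + (i ∸ prev) ≡ i
  prev+i∸prev≡i = ℕ.m+[n∸m]≡n (ℕ.<⇒≤ prev<i)

  count : ∀ j → sumFrom prev (i ∸ prev) (λ _ → δ fzero j) + sumFrom i (n ∸ i) (λ x → δ (fsuc (blockIndex n i is x)) j) ≡
                lookup (compDiffs n prev (i ∷ is)) j
  count fzero = trans (cong₂ _+_ (sumFrom-const prev (i ∸ prev) 1) (sumFrom-const i (n ∸ i) 0))
                      (trans (cong₂ _+_ (ℕ.*-identityʳ (i ∸ prev)) (ℕ.*-zeroʳ (n ∸ i))) (ℕ.+-identityʳ _))
  count (fsuc j) = trans (cong (_+ sumFrom i (n ∸ i) (λ x → δ (blockIndex n i is x) j))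
                               (trans (sumFrom-const prev (i ∸ prev) 0) (ℕ.*-zeroʳ (i ∸ prev))))
                         (blockSize-count n i is inc j)

0<blockSize : ∀ n prev I → Increasing prev I n → ∀ j → 0 < lookup (compDiffs n prev I) j
0<blockSize n prev [] prev<n fzero = ℕ.m<n⇒0<n∸m prev<n
0<blockSize n prev (i ∷ is) (prev<i , _) fzero = ℕ.m<n⇒0<n∸m prev<i
0<blockSize n prev (i ∷ is) (_ , inc) (fsuc j) = 0<blockSize n i is inc j

blockIndex≡⇒blockStart≡ : ∀ n prev I → Increasing prev I n → ∀ x y →
  blockIndex n prev I x ≡ blockIndex n prev I y → blockStart prev I x ≡ blockStart prev I y
blockIndex≡⇒blockStart≡ n prev [] _ x y _ = refl
blockIndex≡⇒blockStart≡ n prev (i ∷ is) (_ , inc) x y eq with x <ᵇ i | y <ᵇ i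
... | true  | true  = refl
... | false | false = blockIndex≡⇒blockStart≡ n i is inc x y (Fin.suc-injective eq)

blockStart≡⇒blockIndex≡ : ∀ n prev I → Increasing prev I n → ∀ x y →
  blockStart prev I x ≡ blockStart prev I y → blockIndex n prev I x ≡ blockIndex n prev I y
blockStart≡⇒blockIndex≡ n prev [] _ x y _ = refl
blockStart≡⇒blockIndex≡ n prev (i ∷ is) (prev<i , inc) x y eq with x <ᵇ i | y <ᵇ i
... | true  | true  = refl
... | true  | false = ⊥-elim (ℕ.<-irrefl refl (ℕ.<-≤-trans prev<i (ℕ.≤-trans (≤-blockStart y inc) (ℕ.≤-reflexive (sym eq)))))
... | false | true  = ⊥-elim (ℕ.<-irrefl refl (ℕ.<-≤-trans prev<i (ℕ.≤-trans (≤-blockStart x inc) (ℕ.≤-reflexive eq))))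
... | false | false = cong fsuc (blockStart≡⇒blockIndex≡ n i is inc x y eq)

-- Left-to-right minima

module LeftToRightMinima {m} (w : Permutation′ (suc m)) where

  pos : Fin (suc m) → ℕ
  pos ℓ = toℕ (w ⟨$⟩ˡ ℓ)

  val : Fin (suc m) → ℕ
  val k = toℕ (w ⟨$⟩ʳ k)

  IsLRM : Fin (suc m) → Set
  IsLRM ℓ = ∀ k → toℕ k < pos ℓ → toℕ ℓ < val k

  isLRM-reflects : ∀ ℓ → Reflects (IsLRM ℓ) (isLRM w ℓ)
  isLRM-reflects ℓ = reflects-map (λ all k → All.lookup all (∈-allFin k)) (λ f → All.tabulate (λ {k} _ → f k))
    (allᵇ-reflects (λ k → if-reflects (ℕ.<ᵇ-reflects-< (toℕ k) (pos ℓ)) (ℕ.<ᵇ-reflects-< (toℕ ℓ) (val k))) (allFin (suc m)))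

  pos-injective : ∀ {ℓ d} → pos ℓ ≡ pos d → ℓ ≡ d
  pos-injective eq = trans (sym (inverseʳ w)) (trans (cong (w ⟨$⟩ʳ_) (Fin.toℕ-injective eq)) (inverseʳ w))

  val≡⇒pos≡ : ∀ {k ℓ} → val k ≡ toℕ ℓ → toℕ k ≡ pos ℓ
  val≡⇒pos≡ eq = cong toℕ (trans (sym (inverseˡ w)) (cong (w ⟨$⟩ˡ_) (Fin.toℕ-injective eq)))

  IsLRM-0 : IsLRM fzero
  IsLRM-0 k k<pos with val k in eq
  ... | suc _ = s≤s z≤n
  ... | zero = ⊥-elim (ℕ.<-irrefl (val≡⇒pos≡ eq) k<pos)

  ¬IsLRM⇒ : ∀ ℓ → ¬ IsLRM ℓ → ∃ λ k → toℕ k < pos ℓ × val k < toℕ ℓ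
  ¬IsLRM⇒ ℓ ¬lrm with Fin.¬∀⟶∃¬ (suc m) _ (λ k → (toℕ k ℕ.<? pos ℓ) →-dec (toℕ ℓ ℕ.<? val k)) ¬lrm
  ... | k , ¬[k<⇒ℓ<] with toℕ k ℕ.<? pos ℓ
  ...   | no k≮ = ⊥-elim (¬[k<⇒ℓ<] λ k< → ⊥-elim (k≮ k<))
  ...   | yes k< with ℕ.m≤n⇒m<n∨m≡n (ℕ.≮⇒≥ (¬[k<⇒ℓ<] ∘ λ ℓ< _ → ℓ<))
  ...     | inj₁ val<ℓ = k , k< , val<ℓ
  ...     | inj₂ val≡ℓ = ⊥-elim (ℕ.<-irrefl (val≡⇒pos≡ val≡ℓ) k<)

  private
    lrm′? : Fin (suc m) → Bool
    lrm′? ℓ = (1 ≤ᵇ toℕ ℓ) ∧ isLRM w ℓ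

  ∈-LRM′⁻ : ∀ {c} → c ∈ LRM′ w → ∃ λ ℓ → toℕ ℓ ≡ c × 1 ≤ toℕ ℓ × IsLRM ℓ
  ∈-LRM′⁻ c∈ with ∈-map∘filter⁻ toℕ (T? ∘ lrm′?) {xs = allFin (suc m)} c∈
  ... | ℓ , _ , refl , t with 1 ≤ᵇ toℕ ℓ | ℕ.≤ᵇ-reflects-≤ 1 (toℕ ℓ) | isLRM w ℓ | isLRM-reflects ℓ
  ...   | true | ofʸ 1≤ℓ | true | ofʸ lrm = ℓ , refl , 1≤ℓ , lrm

  ∈-LRM′⁺ : ∀ {ℓ} → IsLRM ℓ → 1 ≤ toℕ ℓ → toℕ ℓ ∈ LRM′ w
  ∈-LRM′⁺ {ℓ} lrm 1≤ℓ = ∈-map∘filter⁺ toℕ (T? ∘ lrm′?) (ℓ , ∈-allFin ℓ , refl , t)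
    where
    t : T (lrm′? ℓ)
    t rewrite reflects-true (ℕ.≤ᵇ-reflects-≤ 1 (toℕ ℓ)) 1≤ℓ | reflects-true (isLRM-reflects ℓ) lrm = _

  ∈-0∷LRM′⁻ : ∀ {c} → c ∈ 0 ∷ LRM′ w → ∃ λ ℓ → toℕ ℓ ≡ c × IsLRM ℓ
  ∈-0∷LRM′⁻ (here refl) = fzero , refl , IsLRM-0
  ∈-0∷LRM′⁻ (there c∈) with ∈-LRM′⁻ c∈
  ... | ℓ , eq , _ , lrm = ℓ , eq , lrm

  ∈-0∷LRM′⁺ : ∀ {ℓ} → IsLRM ℓ → toℕ ℓ ∈ 0 ∷ LRM′ w
  ∈-0∷LRM′⁺ {fzero} _ = here refl
  ∈-0∷LRM′⁺ {fsuc ℓ} lrm = there (∈-LRM′⁺ lrm (s≤s z≤n))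

  Increasing-LRM′ : Increasing 0 (LRM′ w) (suc m)
  Increasing-LRM′ = AllPairs⇒Increasing
    (AllPairs.map⁺ (AllPairs.filter⁺ (T? ∘ lrm′?) (AllPairs.tabulate⁺-< id)))
    (All.tabulate λ c∈ → let ℓ , eq , 1≤ℓ , _ = ∈-LRM′⁻ c∈ in
      subst (λ c → 0 < c × c < suc m) eq (1≤ℓ , Fin.toℕ<n ℓ))
    (s≤s z≤n)

  sumℕ-cLRM′ : sumℕ (cLRM′ w) ≡ suc m
  sumℕ-cLRM′ = +-sumℕ-compDiffs (suc m) 0 (LRM′ w) Increasing-LRM′

  partialSums-cLRM′ : partialSums (cLRM′ w) ≡ LRM′ w
  partialSums-cLRM′ = partialSumsFrom-compDiffs (suc m) 0 (LRM′ w) Increasing-LRM′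

  open Blocks Increasing-LRM′ public

  st-IsLRM : ∀ x → ∃ λ ℓ → toℕ ℓ ≡ st x × IsLRM ℓ
  st-IsLRM x = ∈-0∷LRM′⁻ (st-∈ x)

  IsLRM⇒≤st : ∀ {ℓ} c → IsLRM ℓ → toℕ ℓ ≤ c → toℕ ℓ ≤ st c
  IsLRM⇒≤st c lrm = st-maximal c (∈-0∷LRM′⁺ lrm)

  st-IsLRM-fixed : ∀ {ℓ} → IsLRM ℓ → st (toℕ ℓ) ≡ toℕ ℓ
  st-IsLRM-fixed lrm = st-fixed (∈-0∷LRM′⁺ lrm)

  IsLRM-pos-< : ∀ {ℓ d} → IsLRM ℓ → IsLRM d → toℕ ℓ < toℕ d → pos d < pos ℓ
  IsLRM-pos-< {ℓ} {d} lrm-ℓ lrm-d ℓ<d with ℕ.<-cmp (pos d) (pos ℓ)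
  ... | tri< pos<pos _ _ = pos<pos
  ... | tri≈ _ pos≡pos _ = ⊥-elim (ℕ.<-irrefl (cong toℕ (pos-injective (sym pos≡pos))) ℓ<d)
  ... | tri> _ _ pos>pos = ⊥-elim (ℕ.<-asym ℓ<d (subst (λ z → toℕ d < toℕ z) (inverseʳ w) (lrm-d (w ⟨$⟩ˡ ℓ) pos>pos)))

  running-min : ∀ v → IsLRM v ⊎ ∃ λ ℓ → IsLRM ℓ × toℕ ℓ < toℕ v × pos ℓ < pos v
  running-min v = go (suc (toℕ v)) v ℕ.≤-refl
    where
    go : ∀ fuel v → toℕ v < fuel → IsLRM v ⊎ ∃ λ ℓ → IsLRM ℓ × toℕ ℓ < toℕ v × pos ℓ < pos v
    go (suc fuel) v v<fuel with isLRM w v | isLRM-reflects v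
    ... | true  | ofʸ lrm = inj₁ lrm
    ... | false | ofⁿ ¬lrm with ¬IsLRM⇒ v ¬lrm
    ...   | k , k<pos , val<v with go fuel (w ⟨$⟩ʳ k) (ℕ.<-≤-trans val<v (ℕ.≤-pred v<fuel))
    ...     | inj₁ lrm = inj₂ (w ⟨$⟩ʳ k , lrm , val<v , subst (λ z → toℕ z < pos v) (sym (inverseˡ w)) k<pos)
    ...     | inj₂ (ℓ , lrm , ℓ< , pos<) =
              inj₂ (ℓ , lrm , ℕ.<-trans ℓ< val<v , ℕ.<-trans pos< (subst (λ z → toℕ z < pos v) (sym (inverseˡ w)) k<pos))

  st-pos-< : ∀ v ℓ → st (toℕ v) ≡ toℕ ℓ → v ≢ ℓ → pos ℓ < pos v
  st-pos-< v ℓ st≡ℓ v≢ℓ with st-IsLRM (toℕ v) | running-min v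
  ... | ℓ′ , ℓ′≡st , lrm-ℓ | _ with Fin.toℕ-injective (trans ℓ′≡st st≡ℓ)
  st-pos-< v ℓ st≡ℓ v≢ℓ | _ , _ , lrm-ℓ | inj₁ lrm-v | refl =
    ⊥-elim (v≢ℓ (Fin.toℕ-injective (trans (sym (st-IsLRM-fixed lrm-v)) st≡ℓ)))
  st-pos-< v ℓ st≡ℓ v≢ℓ | _ , _ , lrm-ℓ | inj₂ (ℓ₁ , lrm-ℓ₁ , ℓ₁<v , pos<) | refl
    with ℕ.m≤n⇒m<n∨m≡n (subst (toℕ ℓ₁ ≤_) st≡ℓ (IsLRM⇒≤st (toℕ v) lrm-ℓ₁ (ℕ.<⇒≤ ℓ₁<v)))
  ... | inj₂ ℓ₁≡ℓ = subst (λ z → pos z < pos v) (Fin.toℕ-injective ℓ₁≡ℓ) pos<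
  ... | inj₁ ℓ₁<ℓ = ℕ.<-trans (IsLRM-pos-< lrm-ℓ₁ lrm-ℓ ℓ₁<ℓ) pos<

-- The refinement order on partitions

sumℕ-map-allFin : ∀ k (g : Fin k → ℕ) → sumℕ (map g (allFin k)) ≡ sum g
sumℕ-map-allFin zero g = refl
sumℕ-map-allFin (suc k) g =
  cong (g fzero +_) (trans (cong sumℕ (trans (map-tabulate fsuc g) (sym (map-tabulate id (g ∘ fsuc))))) (sumℕ-map-allFin k (g ∘ fsuc)))

∑-δ : ∀ {k} (a : Fin k) (h : Fin k → ℕ) → sum (λ i → δ a i * h i) ≡ h a
∑-δ {suc k} fzero h = trans (cong (h fzero + 0 +_) (sum-zero k)) (trans (ℕ.+-identityʳ _) (ℕ.+-identityʳ _))
  where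
  sum-zero : ∀ k → sum {k} (λ _ → 0) ≡ 0
  sum-zero zero = refl
  sum-zero (suc k) = sum-zero k
∑-δ {suc k} (fsuc a) h = ∑-δ a (h ∘ fsuc)

⪯π-resp-↭ : ∀ {λ₁ μ₁ λ₂ μ₂} → λ₁ ⪯π μ₁ → λ₁ ↭ λ₂ → μ₁ ↭ μ₂ → λ₂ ⪯π μ₂
⪯π-resp-↭ {λ₁} {μ₁} {λ₂} {μ₂} (f , μ₁≡) λ₁↭λ₂ μ₁↭μ₂ = f₂ , μ₂≡
  where
  ρλ = onIndices (↭⇒↭ₛ λ₁↭λ₂)
  ρμ = onIndices (↭⇒↭ₛ μ₁↭μ₂)

  f₂ : Fin (length λ₂) → Fin (length μ₂)
  f₂ i = ρμ ⟨$⟩ʳ f (ρλ ⟨$⟩ˡ i)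

  term₁ : Fin (length μ₂) → Fin (length λ₁) → ℕ
  term₁ j i = if toℕ (f i) ≡ᵇ toℕ (ρμ ⟨$⟩ˡ j) then lookup λ₁ i else 0

  reindex : ∀ j i → term₁ j (ρλ ⟨$⟩ˡ i) ≡ (if toℕ (f₂ i) ≡ᵇ toℕ j then lookup λ₂ i else 0)
  reindex j i rewrite reflects-≡ (Fin-≡ᵇ-reflects (f (ρλ ⟨$⟩ˡ i)) (ρμ ⟨$⟩ˡ j)) (Fin-≡ᵇ-reflects (f₂ i) j)
                        (λ eq → trans (cong (ρμ ⟨$⟩ʳ_) eq) (inverseʳ ρμ)) (λ eq → trans (sym (inverseˡ ρμ)) (cong (ρμ ⟨$⟩ˡ_) eq))
    with toℕ (f₂ i) ≡ᵇ toℕ j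
  ... | true  = trans (onIndices-lookup (↭⇒↭ₛ λ₁↭λ₂) (ρλ ⟨$⟩ˡ i)) (cong (lookup λ₂) (inverseʳ ρλ))
  ... | false = refl

  μ₂≡ : ∀ j → lookup μ₂ j ≡ sumℕ (map (λ i → if toℕ (f₂ i) ≡ᵇ toℕ j then lookup λ₂ i else 0) (allFin (length λ₂)))
  μ₂≡ j = begin
    lookup μ₂ j                                        ≡⟨ cong (lookup μ₂) (inverseʳ ρμ) ⟨
    lookup μ₂ (ρμ ⟨$⟩ʳ (ρμ ⟨$⟩ˡ j))                    ≡⟨ onIndices-lookup (↭⇒↭ₛ μ₁↭μ₂) (ρμ ⟨$⟩ˡ j) ⟨
    lookup μ₁ (ρμ ⟨$⟩ˡ j)                              ≡⟨ μ₁≡ (ρμ ⟨$⟩ˡ j) ⟩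
    sumℕ (map (term₁ j) (allFin (length λ₁)))          ≡⟨ sumℕ-map-allFin _ (term₁ j) ⟩
    sum (term₁ j)                                      ≡⟨ sum-permute (term₁ j) (flip ρλ) ⟩
    sum (λ i → term₁ j (ρλ ⟨$⟩ˡ i))                    ≡⟨ sum-cong-≗ (reindex j) ⟩
    sum (λ i → if toℕ (f₂ i) ≡ᵇ toℕ j then lookup λ₂ i else 0)
      ≡⟨ sumℕ-map-allFin (length λ₂) (λ i → if toℕ (f₂ i) ≡ᵇ toℕ j then lookup λ₂ i else 0) ⟨
    sumℕ (map (λ i → if toℕ (f₂ i) ≡ᵇ toℕ j then lookup λ₂ i else 0) (allFin (length λ₂))) ∎
    where open ≡-Reasoning

insertDec-↭ : ∀ x ys → insertDec x ys ↭ x ∷ ys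
insertDec-↭ x [] = ↭-refl
insertDec-↭ x (y ∷ ys) with y <ᵇ x
... | true  = ↭-refl
... | false = ↭-trans (prep y (insertDec-↭ x ys)) (swap y x ↭-refl)

sortDec-↭ : ∀ xs → sortDec xs ↭ xs
sortDec-↭ [] = ↭-refl
sortDec-↭ (x ∷ xs) = ↭-trans (insertDec-↭ x (sortDec xs)) (prep x (sortDec-↭ xs))

surjective-non-injective⇒< : ∀ {p q} (f : Fin p → Fin q) → (∀ j → ∃ λ i → f i ≡ j) →
  ∀ {i₁ i₂} → i₁ ≢ i₂ → f i₁ ≡ f i₂ → q < p
surjective-non-injective⇒< {suc p} {q} f surj {i₁} {i₂} i₁≢i₂ fi₁≡fi₂ =
  s≤s (Fin.injective⇒≤ {f = section} section-injective)
  where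
  -- preimages avoiding i₂ give an injection Fin q → Fin p
  preimage : ∀ j → ∃ λ i → i₂ ≢ i × f i ≡ j
  preimage j with proj₁ (surj j) Fin.≟ i₂
  ... | yes i≡i₂ = i₁ , i₁≢i₂ ∘ sym , trans fi₁≡fi₂ (trans (cong f (sym i≡i₂)) (proj₂ (surj j)))
  ... | no i≢i₂ = proj₁ (surj j) , i≢i₂ ∘ sym , proj₂ (surj j)

  section : Fin q → Fin p
  section j = punchOut (proj₁ (proj₂ (preimage j)))

  f∘section : ∀ j → f (punchIn i₂ (section j)) ≡ j
  f∘section j = trans (cong f (Fin.punchIn-punchOut (proj₁ (proj₂ (preimage j))))) (proj₂ (proj₂ (preimage j)))

  section-injective : ∀ {a b} → section a ≡ section b → a ≡ b
  section-injective {a} {b} eq = trans (sym (f∘section a)) (trans (cong (f ∘ punchIn i₂) eq) (f∘section b))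

-- Comparing two permutations

clamp : ∀ m → ℕ → Fin (suc m)
clamp zero c = fzero
clamp (suc m) zero = fzero
clamp (suc m) (suc c) = fsuc (clamp m c)

clamp-toℕ : ∀ m (x : Fin (suc m)) → clamp m (toℕ x) ≡ x
clamp-toℕ zero fzero = refl
clamp-toℕ (suc m) fzero = refl
clamp-toℕ (suc m) (fsuc x) = cong fsuc (clamp-toℕ m x)

toℕ-clamp : ∀ m c → c ≤ m → toℕ (clamp m c) ≡ c
toℕ-clamp zero zero _ = refl
toℕ-clamp (suc m) zero _ = refl
toℕ-clamp (suc m) (suc c) (s≤s c≤m) = cong suc (toℕ-clamp m c c≤m)

increasing-self-map≡id : ∀ m (g : ℕ → ℕ) → (∀ k → k < m → g k < g (suc k)) → (∀ k → k ≤ m → g k ≤ m) →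
  ∀ k → k ≤ m → g k ≡ k
increasing-self-map≡id m g inc bounded k k≤m = ℕ.≤-antisym (down (m ∸ k) k (ℕ.m∸n+n≡m k≤m)) (up k k≤m)
  where
  up : ∀ k → k ≤ m → k ≤ g k
  up zero _ = z≤n
  up (suc k) k<m = ℕ.≤-<-trans (up k (ℕ.<⇒≤ k<m)) (inc k k<m)
  down : ∀ j k → j + k ≡ m → g k ≤ k
  down zero k refl = bounded k ℕ.≤-refl
  down (suc j) k j+k+1≡m = ℕ.≤-pred (ℕ.<-≤-trans (inc k k<m) (down j (suc k) (trans (ℕ.+-suc j k) j+k+1≡m)))
    where
    k<m : k < m
    k<m = subst (k <_) j+k+1≡m (s≤s (ℕ.m≤n+m k j))

⊆-or-counterexample : ∀ {n p q} {P : Fin n → Fin n → Set p} {Q : Fin n → Fin n → Set q} →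
  (∀ x y → Dec (P x y)) → (∀ x y → Dec (Q x y)) → (∀ x y → P x y → Q x y) ⊎ ∃₂ λ x y → P x y × ¬ Q x y
⊆-or-counterexample {n} P? Q? with Fin.all? (λ x → Fin.all? (λ y → P? x y →-dec Q? x y))
... | yes P⊆Q = inj₁ P⊆Q
... | no ¬P⊆Q with Fin.¬∀⟶∃¬ n _ (λ x → Fin.all? (λ y → P? x y →-dec Q? x y)) ¬P⊆Q
...   | x , ¬∀y with Fin.¬∀⟶∃¬ n _ (λ y → P? x y →-dec Q? x y) ¬∀y
...     | y , ¬[P⇒Q] with P? x y
...       | yes pxy = inj₂ (x , y , pxy , λ qxy → ¬[P⇒Q] λ _ → qxy)
...       | no ¬pxy = ⊥-elim (¬[P⇒Q] λ pxy → ⊥-elim (¬pxy pxy))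

module Comparing {m} (u w : Permutation′ (suc m)) where

  module U = LeftToRightMinima u
  module W = LeftToRightMinima w

  C : List (ℕ × ℕ)
  C = constraints (LRM′ u) (letterAt u w)

  π ρ : Fin (suc m) → Fin (suc m)
  π j = w ⟨$⟩ʳ (u ⟨$⟩ˡ j)
  ρ x = u ⟨$⟩ʳ (w ⟨$⟩ˡ x)

  ρ∘π : ∀ j → ρ (π j) ≡ j
  ρ∘π j = trans (cong (u ⟨$⟩ʳ_) (inverseˡ w)) (inverseʳ u)

  π∘ρ : ∀ x → π (ρ x) ≡ x
  π∘ρ x = trans (cong (w ⟨$⟩ʳ_) (inverseˡ u)) (inverseʳ w)

  -- The colour of a value x of w is the u-block of the value u takes at the position of x.
  colour : Fin (suc m) → ℕ
  colour x = U.st (toℕ (ρ x))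

  κ : ℕ → ℕ
  κ c = colour (clamp m (c ∸ 1))

  κ-letter : ∀ x → κ (suc (toℕ x)) ≡ colour x
  κ-letter x = cong colour (clamp-toℕ m x)

  κ-letterAt : ∀ j → κ (letterAt u w j) ≡ U.st (toℕ j)
  κ-letterAt j = trans (κ-letter (π j)) (cong (U.st ∘ toℕ) (ρ∘π j))

  ∈C⁻ : ∀ {c} → c ∈ C → ∃ λ (i : Fin m) → c ≡ (letterAt u w (inject₁ i) , letterAt u w (fsuc i)) × suc (toℕ i) ∉ LRM′ u
  ∈C⁻ c∈ with ∈-map⁻ _ c∈
  ... | i , i∈ , refl with ∈-filter⁻ (T? ∘ λ i → not (memℕ (suc (toℕ i)) (LRM′ u))) {xs = allFin m} i∈
  ...   | _ , t = i , refl , not-memℕ t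
    where
    not-memℕ : ∀ {x xs} → T (not (memℕ x xs)) → x ∉ xs
    not-memℕ {x} {xs} t x∈ with memℕ x xs | ∈⇒memℕ {x} {xs} x∈
    not-memℕ () x∈ | true | _

  ∈C⁺ : ∀ (i : Fin m) → suc (toℕ i) ∉ LRM′ u → (letterAt u w (inject₁ i) , letterAt u w (fsuc i)) ∈ C
  ∈C⁺ i i+1∉ = ∈-map⁺ _ (∈-filter⁺ (T? ∘ λ i → not (memℕ (suc (toℕ i)) (LRM′ u))) (∈-allFin i) t)
    where
    t : T (not (memℕ (suc (toℕ i)) (LRM′ u)))
    t rewrite ∉⇒memℕ i+1∉ = _

  U-st-suc : ∀ (i : Fin m) → suc (toℕ i) ∉ LRM′ u → U.st (toℕ (fsuc i)) ≡ U.st (toℕ (inject₁ i))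
  U-st-suc i i+1∉ = trans (U.st-suc (toℕ i) i+1∉) (cong U.st (sym (Fin.toℕ-inject₁ i)))

  κ-resp-C : ∀ {x y} → (x , y) ∈ C → κ x ≡ κ y
  κ-resp-C xy∈ with ∈C⁻ xy∈
  ... | i , refl , i+1∉ = trans (κ-letterAt (inject₁ i)) (trans (sym (U-st-suc i i+1∉)) (sym (κ-letterAt (fsuc i))))

  ¬U-LRM⇒ : ∀ d → ¬ U.IsLRM d → ∃ λ (i : Fin m) → d ≡ fsuc i × suc (toℕ i) ∉ LRM′ u
  ¬U-LRM⇒ fzero ¬lrm = ⊥-elim (¬lrm U.IsLRM-0)
  ¬U-LRM⇒ (fsuc i) ¬lrm = i , refl , λ i+1∈ → let ℓ , eq , _ , lrm = U.∈-LRM′⁻ i+1∈ in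
    ¬lrm (subst U.IsLRM (Fin.toℕ-injective {j = fsuc i} eq) lrm)

  Monochromatic : Set
  Monochromatic = ∀ x y → W.st (toℕ x) ≡ W.st (toℕ y) → colour x ≡ colour y

  Separating : Set
  Separating = ∀ x y → colour x ≡ colour y → W.st (toℕ x) ≡ W.st (toℕ y)

  -- Otherwise the leader ℓ of the w-block of w q sits at some q₁ ≢ q, and q₁ would lie
  -- after q (u q leads the u-block of u q₁) and before q (ℓ leads the w-block of w q).
  U-LRM⇒W-LRM : Monochromatic → ∀ q → U.IsLRM (u ⟨$⟩ʳ q) → W.IsLRM (w ⟨$⟩ʳ q)
  U-LRM⇒W-LRM mono q lrm-u with W.st-IsLRM (toℕ (w ⟨$⟩ʳ q))
  ... | ℓ , ℓ≡st , lrm-ℓ with (w ⟨$⟩ˡ ℓ) Fin.≟ q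
  ...   | yes refl = subst W.IsLRM (sym (inverseʳ w)) lrm-ℓ
  ...   | no q₁≢q = ⊥-elim (ℕ.<-asym q<q₁ q₁<q)
    where
    q₁ = w ⟨$⟩ˡ ℓ
    same-u-block : U.st (toℕ (u ⟨$⟩ʳ q₁)) ≡ toℕ (u ⟨$⟩ʳ q)
    same-u-block = trans (mono ℓ (w ⟨$⟩ʳ q) (trans (W.st-IsLRM-fixed lrm-ℓ) ℓ≡st))
                         (trans (cong (λ k → U.st (toℕ (u ⟨$⟩ʳ k))) (inverseˡ w)) (U.st-IsLRM-fixed lrm-u))
    q<q₁ : toℕ q < toℕ q₁
    q<q₁ = subst₂ (λ a b → toℕ a < toℕ b) (inverseˡ u) (inverseˡ u)
             (U.st-pos-< (u ⟨$⟩ʳ q₁) (u ⟨$⟩ʳ q) same-u-block (q₁≢q ∘ ⟨$⟩ʳ-injective u))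
    q₁<q : toℕ q₁ < toℕ q
    q₁<q = subst (λ b → toℕ q₁ < toℕ b) (inverseˡ w)
             (W.st-pos-< (w ⟨$⟩ʳ q) ℓ (sym ℓ≡st) (λ eq → q₁≢q (trans (cong (w ⟨$⟩ˡ_) (sym eq)) (inverseˡ w))))

  Ascending : Set
  Ascending = ∀ {x y} → (x , y) ∈ C → x ≤ y

  -- Inside a u-block this is the ascending constraint.  If i + 1 opens a u-block, the
  -- positions of i + 1 and of the leader of the u-block of i carry left-to-right minima
  -- of w (U-LRM⇒W-LRM), and these pin π i below π (i + 1).
  π-increasing : Monochromatic → Separating → Ascending → ∀ (i : Fin m) → toℕ (π (inject₁ i)) < toℕ (π (fsuc i))
  π-increasing mono sep asc i with memℕ (suc (toℕ i)) (LRM′ u) | memℕ-reflects (suc (toℕ i)) (LRM′ u)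
  ... | false | ofⁿ i+1∉ =
    ℕ.≤∧≢⇒< (ℕ.≤-pred (asc (∈C⁺ i i+1∉))) (λ eq → inject₁≢fsuc i (letterAt-injective u w (cong suc eq)))
  ... | true | ofʸ i+1∈ with U.∈-LRM′⁻ i+1∈ | U.st-IsLRM (toℕ (inject₁ i))
  ...   | d , d≡ , _ , lrm-d | ℓ₀ , ℓ₀≡st , lrm-ℓ₀ with Fin.toℕ-injective {j = fsuc i} d≡
  ...     | refl = ℕ.≰⇒> π-fsuc≰
    where
    qd = u ⟨$⟩ˡ fsuc i
    qℓ = u ⟨$⟩ˡ ℓ₀
    qd<qℓ : toℕ qd < toℕ qℓ
    qd<qℓ = U.IsLRM-pos-< lrm-ℓ₀ lrm-d
      (s≤s (ℕ.≤-trans (ℕ.≤-reflexive ℓ₀≡st) (ℕ.≤-trans (U.st-≤ (toℕ (inject₁ i))) (ℕ.≤-reflexive (Fin.toℕ-inject₁ i)))))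
    W-LRM : ∀ {d} → U.IsLRM d → W.IsLRM (w ⟨$⟩ʳ (u ⟨$⟩ˡ d))
    W-LRM lrm = U-LRM⇒W-LRM mono _ (subst U.IsLRM (sym (inverseʳ u)) lrm)
    wqℓ<wqd : toℕ (w ⟨$⟩ʳ qℓ) < toℕ (w ⟨$⟩ʳ qd)
    wqℓ<wqd = W-LRM lrm-ℓ₀ qd (subst (λ k → toℕ qd < toℕ k) (sym (inverseˡ w)) qd<qℓ)
    same-colour : colour (π (inject₁ i)) ≡ colour (w ⟨$⟩ʳ qℓ)
    same-colour = trans (cong (U.st ∘ toℕ) (ρ∘π (inject₁ i)))
                 (trans (sym ℓ₀≡st) (trans (sym (U.st-IsLRM-fixed lrm-ℓ₀)) (cong (U.st ∘ toℕ) (sym (ρ∘π ℓ₀)))))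
    π-fsuc≰ : toℕ (π (fsuc i)) ≰ toℕ (π (inject₁ i))
    π-fsuc≰ π-fsuc≤ = ℕ.<-irrefl refl (ℕ.<-≤-trans wqℓ<wqd (ℕ.≤-trans (W.IsLRM⇒≤st _ (W-LRM lrm-d) π-fsuc≤)
      (ℕ.≤-reflexive (trans (sep _ _ same-colour) (W.st-IsLRM-fixed (W-LRM lrm-ℓ₀))))))

  u≗w : Monochromatic → Separating → Ascending → ∀ i → u ⟨$⟩ʳ i ≡ w ⟨$⟩ʳ i
  u≗w mono sep asc i = sym (trans (cong (w ⟨$⟩ʳ_) (sym (inverseˡ u))) (π≗id (u ⟨$⟩ʳ i)))
    where
    g : ℕ → ℕ
    g k = toℕ (π (clamp m k))
    g-increasing : ∀ k → k < m → g k < g (suc k)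
    g-increasing k k<m = subst₂ (λ a b → toℕ (π a) < toℕ (π b))
      (trans (sym (clamp-toℕ m _)) (cong (clamp m) (trans (Fin.toℕ-inject₁ _) (Fin.toℕ-fromℕ< k<m))))
      (trans (sym (clamp-toℕ m _)) (cong (clamp m ∘ suc) (Fin.toℕ-fromℕ< k<m)))
      (π-increasing mono sep asc (fromℕ< k<m))
    π≗id : ∀ x → π x ≡ x
    π≗id x = Fin.toℕ-injective (trans (cong (toℕ ∘ π) (sym (clamp-toℕ m x)))
      (increasing-self-map≡id m g g-increasing (λ k _ → ℕ.≤-pred (Fin.toℕ<n _)) (toℕ x) (ℕ.≤-pred (Fin.toℕ<n x))))

  block-letter : Monochromatic → Separating → ∀ {x₀} (i : Fin m) → suc (toℕ i) ∉ LRM′ u →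
    W.st (toℕ (π (fsuc i))) ≡ W.st (toℕ x₀) → letterAt u w (inject₁ i) ∈ W.block (toℕ x₀)
  block-letter mono sep {x₀} i i+1∉ st≡ = W.∈-block⁺ (Fin.toℕ<n x₀) (Fin.toℕ<n _)
    (trans (sep _ _ (trans (cong (U.st ∘ toℕ) (ρ∘π (inject₁ i)))
                    (trans (sym (U-st-suc i i+1∉)) (cong (U.st ∘ toℕ) (sym (ρ∘π (fsuc i))))))) st≡)

  -- For a letter y + 1 of the block other than the first, y is no w-leader, so ρ y = i + 1
  -- is no u-leader and the constraint for i ends at y + 1.
  Chained-block : Monochromatic → Separating → ∀ x₀ → Chained C (W.st (toℕ x₀)) (W.en (toℕ x₀) ∸ W.st (toℕ x₀))
  Chained-block mono sep x₀ z∈ z≢ with W.∈-block⁻ (Fin.toℕ<n x₀) z∈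
  ... | y , refl , st-y≡ , y<n =
    letterAt u w (inject₁ i) , subst (λ z → (letterAt u w (inject₁ i) , z) ∈ C) letter≡ (∈C⁺ i i+1∉) ,
    (λ eq → inject₁≢fsuc i (letterAt-injective u w (trans eq (sym letter≡)))) ,
    block-letter mono sep i i+1∉ (trans (cong (W.st ∘ toℕ) π-fsuc≡) (trans (cong W.st toℕ-yf) st-y≡))
    where
    yf = clamp m y
    toℕ-yf : toℕ yf ≡ y
    toℕ-yf = toℕ-clamp m y (ℕ.≤-pred y<n)
    ¬W-LRM : ¬ W.IsLRM yf
    ¬W-LRM lrm = z≢ (cong suc (trans (sym toℕ-yf) (trans (sym (W.st-IsLRM-fixed lrm)) (trans (cong W.st toℕ-yf) st-y≡))))
    ¬U-LRM : ¬ U.IsLRM (ρ yf)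
    ¬U-LRM lrm = ¬W-LRM (subst W.IsLRM (inverseʳ w) (U-LRM⇒W-LRM mono (w ⟨$⟩ˡ yf) lrm))
    i = proj₁ (¬U-LRM⇒ (ρ yf) ¬U-LRM)
    i+1∉ = proj₂ (proj₂ (¬U-LRM⇒ (ρ yf) ¬U-LRM))
    π-fsuc≡ : π (fsuc i) ≡ yf
    π-fsuc≡ = trans (cong π (sym (proj₁ (proj₂ (¬U-LRM⇒ (ρ yf) ¬U-LRM))))) (π∘ρ yf)
    letter≡ : letterAt u w (fsuc i) ≡ suc y
    letter≡ = cong suc (trans (cong toℕ π-fsuc≡) toℕ-yf)

  DescentOn-block : Monochromatic → Separating → ∀ {x y} → (x , y) ∈ C → y < x →
    ∃ λ (x₀ : Fin (suc m)) → DescentOn C (W.block (toℕ x₀))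
  DescentOn-block mono sep xy∈ y<x with ∈C⁻ xy∈
  ... | i , refl , i+1∉ = π (fsuc i) , letterAt u w (inject₁ i) , letterAt u w (fsuc i) , xy∈ ,
    block-letter mono sep i i+1∉ refl , W.∈-block⁺ (Fin.toℕ<n (π (fsuc i))) (Fin.toℕ<n (π (fsuc i))) refl , y<x

  TwoColoured-block : ∀ {x y} → W.st (toℕ x) ≡ W.st (toℕ y) → colour x ≢ colour y → TwoColoured κ (W.block (toℕ x))
  TwoColoured-block {x} {y} st≡ colour≢ =
    suc (toℕ x) , suc (toℕ y) , W.∈-block⁺ (Fin.toℕ<n x) (Fin.toℕ<n x) refl , W.∈-block⁺ (Fin.toℕ<n x) (Fin.toℕ<n y) (sym st≡) ,
    λ eq → colour≢ (trans (sym (κ-letter x)) (trans eq (κ-letter y)))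

  -- Monochromatic w-blocks make cLRM′ w a refinement of cLRM′ u.

  β γ : List ℕ
  β = cLRM′ w
  γ = cLRM′ u

  blockβ : ℕ → Fin (length β)
  blockβ = blockIndex (suc m) 0 (LRM′ w)

  blockγ : ℕ → Fin (length γ)
  blockγ = blockIndex (suc m) 0 (LRM′ u)

  module Refinement (mono : Monochromatic) where

    blockMapFor : ∀ i → Dec (∃ λ x → blockβ (toℕ x) ≡ i) → Fin (length γ)
    blockMapFor i (yes (x , _)) = blockγ (toℕ (ρ x))
    blockMapFor i (no _) = blockγ 0

    -- the u-block containing the image under ρ of the i-th w-block
    blockMap : Fin (length β) → Fin (length γ)
    blockMap i = blockMapFor i (Fin.any? (λ x → blockβ (toℕ x) Fin.≟ i))

    blockMap-blockβ : ∀ x → blockMap (blockβ (toℕ x)) ≡ blockγ (toℕ (ρ x))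
    blockMap-blockβ x = for-any-decision (Fin.any? (λ x′ → blockβ (toℕ x′) Fin.≟ blockβ (toℕ x)))
      where
      for-any-decision : ∀ d → blockMapFor (blockβ (toℕ x)) d ≡ blockγ (toℕ (ρ x))
      for-any-decision (no ∄x′) = ⊥-elim (∄x′ (x , refl))
      for-any-decision (yes (x′ , eq)) = blockStart≡⇒blockIndex≡ (suc m) 0 (LRM′ u) U.Increasing-LRM′ _ _
        (mono x′ x (blockIndex≡⇒blockStart≡ (suc m) 0 (LRM′ w) W.Increasing-LRM′ _ _ eq))

    γ-sizes : ∀ j → lookup γ j ≡ sumℕ (map (λ i → if toℕ (blockMap i) ≡ᵇ toℕ j then lookup β i else 0) (allFin (length β)))
    -- count the values x by the u-block of ρ x, which blockMap reads off the w-block of x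
    γ-sizes j = begin
      lookup γ j
        ≡⟨ blockSize-count (suc m) 0 (LRM′ u) U.Increasing-LRM′ j ⟨
      sumFrom 0 (suc m) (λ y → δ (blockγ y) j)
        ≡⟨ sumFrom≡sum 0 (suc m) _ ⟩
      sum {suc m} (λ y → δ (blockγ (toℕ y)) j)
        ≡⟨ sum-permute (λ y → δ (blockγ (toℕ y)) j) (flip w ∘ₚ u) ⟩
      sum {suc m} (λ x → δ (blockγ (toℕ (ρ x))) j)
        ≡⟨ sum-cong-≗ (λ x → cong (λ (b : Fin (length γ)) → δ b j) (sym (blockMap-blockβ x))) ⟩
      sum {suc m} (λ x → δ (blockMap (blockβ (toℕ x))) j)
        ≡⟨ sum-cong-≗ {suc m} (λ x → sym (∑-δ (blockβ (toℕ x)) (λ i → δ (blockMap i) j))) ⟩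
      sum {suc m} (λ x → sum {length β} (λ i → δ (blockβ (toℕ x)) i * δ (blockMap i) j))
        ≡⟨ ∑-comm {suc m} {length β} (λ x i → δ (blockβ (toℕ x)) i * δ (blockMap i) j) ⟩
      sum {length β} (λ i → sum {suc m} (λ x → δ (blockβ (toℕ x)) i * δ (blockMap i) j))
        ≡⟨ sum-cong-≗ {length β} (λ i → sym (*-distribʳ-sum {suc m} (δ (blockMap i) j) (λ x → δ (blockβ (toℕ x)) i))) ⟩
      sum {length β} (λ i → sum {suc m} (λ x → δ (blockβ (toℕ x)) i) * δ (blockMap i) j)
        ≡⟨ sum-cong-≗ (λ i → cong (_* δ (blockMap i) j) (β-size i)) ⟩
      sum {length β} (λ i → lookup β i * δ (blockMap i) j)
        ≡⟨ sum-cong-≗ term ⟩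
      sum {length β} (λ i → if toℕ (blockMap i) ≡ᵇ toℕ j then lookup β i else 0)
        ≡⟨ sumℕ-map-allFin (length β) _ ⟨
      sumℕ (map (λ i → if toℕ (blockMap i) ≡ᵇ toℕ j then lookup β i else 0) (allFin (length β))) ∎
      where
      open ≡-Reasoning
      β-size : ∀ i → sum {suc m} (λ x → δ (blockβ (toℕ x)) i) ≡ lookup β i
      β-size i = trans (sym (sumFrom≡sum 0 (suc m) _)) (blockSize-count (suc m) 0 (LRM′ w) W.Increasing-LRM′ i)
      term : ∀ i → lookup β i * δ (blockMap i) j ≡ (if toℕ (blockMap i) ≡ᵇ toℕ j then lookup β i else 0)
      term i with toℕ (blockMap i) ≡ᵇ toℕ j
      ... | true  = ℕ.*-identityʳ (lookup β i)
      ... | false = ℕ.*-zeroʳ (lookup β i)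

    blockMap-surjective : ∀ j → ∃ λ i → blockMap i ≡ j
    blockMap-surjective j with Fin.any? (λ i → blockMap i Fin.≟ j)
    ... | yes found = found
    ... | no ∄i = ⊥-elim (ℕ.<-irrefl (sym γj≡0) (0<blockSize (suc m) 0 (LRM′ u) U.Increasing-LRM′ j))
      where
      γj≡0 : lookup γ j ≡ 0
      γj≡0 = trans (γ-sizes j) (trans (sumℕ-map-allFin (length β) _) (trans (sum-cong-≗ {length β} zero-term) (sum-replicate-zero (length β))))
        where
        zero-term : ∀ i → (if toℕ (blockMap i) ≡ᵇ toℕ j then lookup β i else 0) ≡ 0
        zero-term i rewrite reflects-false (Fin-≡ᵇ-reflects (blockMap i) j) (λ eq → ∄i (i , eq)) = refl

    ¬Separating⇒≺π : ∀ {x y} → colour x ≡ colour y → W.st (toℕ x) ≢ W.st (toℕ y) → sortDec β ≺π sortDec γ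
    ¬Separating⇒≺π {x} {y} colour≡ st≢ =
      ⪯π-resp-↭ (blockMap , γ-sizes) (↭-sym (sortDec-↭ β)) (↭-sym (sortDec-↭ γ)) , λ eq →
        ℕ.<-irrefl (trans (sym (↭-length (sortDec-↭ γ))) (trans (cong length (sym eq)) (↭-length (sortDec-↭ β)))) fewer-blocks
      where
      fewer-blocks : length γ < length β
      fewer-blocks = surjective-non-injective⇒< blockMap blockMap-surjective
        (st≢ ∘ blockIndex≡⇒blockStart≡ (suc m) 0 (LRM′ w) W.Increasing-LRM′ _ _)
        (trans (blockMap-blockβ x) (trans (blockStart≡⇒blockIndex≡ (suc m) 0 (LRM′ u) U.Increasing-LRM′ _ _ colour≡)
               (sym (blockMap-blockβ y))))

module SelfComparison {m} (w : Permutation′ (suc m)) where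
  open Comparing w w public

  letterAt-id : ∀ j → letterAt w w j ≡ suc (toℕ j)
  letterAt-id j = cong (suc ∘ toℕ) (inverseʳ w)

  ascending : Ascending
  ascending xy∈ with ∈C⁻ xy∈
  ... | i , refl , _ = subst₂ _≤_ (sym (letterAt-id (inject₁ i))) (sym (letterAt-id (fsuc i)))
    (s≤s (ℕ.≤-trans (ℕ.≤-reflexive (Fin.toℕ-inject₁ i)) (ℕ.n≤1+n _)))

  adjacent∈C : ∀ {i₀} → i₀ < m → suc i₀ ∉ LRM′ w → (suc i₀ , suc (suc i₀)) ∈ C
  adjacent∈C {i₀} i₀<m i₀+1∉ =
    subst₂ (λ x y → (x , y) ∈ C)
      (trans (letterAt-id (inject₁ i)) (cong suc (trans (Fin.toℕ-inject₁ i) (Fin.toℕ-fromℕ< i₀<m))))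
      (trans (letterAt-id (fsuc i)) (cong (suc ∘ suc) (Fin.toℕ-fromℕ< i₀<m)))
      (∈C⁺ i (subst (λ k → suc k ∉ LRM′ w) (sym (Fin.toℕ-fromℕ< i₀<m)) i₀+1∉))
    where
    i = fromℕ< i₀<m

  Block⇒Chained : ∀ {s a} → Block 0 β s a → Chained C s a
  Block⇒Chained {s} {a} blk {y} y∈ y≢ with Block-compDiffs⇒ (suc m) 0 (LRM′ w) W.Increasing-LRM′ blk | ∈-interval⁻ s a y∈
  ... | _ , s+a≤n , same-start | s<y , y≤s+a = chain y s<y y≤s+a y≢
    where
    chain : ∀ y → s < y → y ≤ s + a → y ≢ suc s → ∃ λ x → (x , y) ∈ C × x ≢ y × x ∈ interval s a
    chain (suc zero) s<1 _ 1≢s+1 = ⊥-elim (1≢s+1 (cong suc (sym (ℕ.n<1⇒n≡0 s<1))))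
    chain (suc (suc i₀)) s<y y≤ y≢ =
      suc i₀ , adjacent∈C i₀<m (z∉ ∘ there) , (λ ()) , ∈-interval⁺ s a (ℕ.≤∧≢⇒< s≤z (z≢s ∘ sym)) (ℕ.<⇒≤ z<)
      where
      s≤z = ℕ.≤-pred s<y
      z< : suc i₀ < s + a
      z< = y≤
      z≢s : suc i₀ ≢ s
      z≢s = y≢ ∘ cong suc
      z∉ : suc i₀ ∉ 0 ∷ LRM′ w
      z∉ z∈ = z≢s (trans (sym (W.st-fixed z∈)) (same-start (suc i₀) s≤z z<))
      i₀<m : i₀ < m
      i₀<m = ℕ.≤-pred (ℕ.≤-pred (ℕ.≤-trans (s≤s y≤) (s≤s s+a≤n)))

-- Weights over a commutative ring

module _ {c ℓ} (R : CommutativeRing c ℓ) where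
  open CommutativeRing R hiding (zero)
    renaming (_+_ to _+ᴿ_; _*_ to _*ᴿ_; refl to ≈-refl; sym to ≈-sym; trans to ≈-trans; reflexive to ≈-reflexive)
  open FreeAlg R
  open import Algebra.Properties.Ring ring using (-0#≈0#; -‿+-comm)
  open import Algebra.Properties.CommutativeSemigroup +-commutativeSemigroup using () renaming (interchange to +-interchange)
  open import Relation.Binary.Reasoning.Setoid setoid

  ∑ : List A → (A → Carrier) → Carrier
  ∑ xs g = foldr (λ x acc → g x +ᴿ acc) 0# xs

  syntax ∑ xs (λ x → g) = ∑[ x ∈ xs ] g

  ∑-cong : ∀ (xs : List A) {g h : A → Carrier} → (∀ x → g x ≈ h x) → ∑ xs g ≈ ∑ xs h
  ∑-cong [] _ = ≈-refl
  ∑-cong (x ∷ xs) g≈h = +-cong (g≈h x) (∑-cong xs g≈h)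

  ∑-congᴬ : ∀ {p} {P : A → Set p} {xs : List A} {g h : A → Carrier} →
            All P xs → (∀ {x} → P x → g x ≈ h x) → ∑ xs g ≈ ∑ xs h
  ∑-congᴬ [] _ = ≈-refl
  ∑-congᴬ (px ∷ pxs) g≈h = +-cong (g≈h px) (∑-congᴬ pxs g≈h)

  ∑-++ : ∀ (xs ys : List A) g → ∑ (xs ++ ys) g ≈ ∑ xs g +ᴿ ∑ ys g
  ∑-++ [] ys g = ≈-sym (+-identityˡ _)
  ∑-++ (x ∷ xs) ys g = ≈-trans (+-congˡ (∑-++ xs ys g)) (≈-sym (+-assoc _ _ _))

  ∑-map : ∀ (f : B → A) xs g → ∑ (map f xs) g ≡ ∑[ x ∈ xs ] g (f x)
  ∑-map f [] g = refl
  ∑-map f (x ∷ xs) g = cong (g (f x) +ᴿ_) (∑-map f xs g)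

  ∑-concatMap : ∀ (f : B → List A) xs g → ∑ (concatMap f xs) g ≈ ∑[ x ∈ xs ] ∑ (f x) g
  ∑-concatMap f [] g = ≈-refl
  ∑-concatMap f (x ∷ xs) g = ≈-trans (∑-++ (f x) (concatMap f xs) g) (+-congˡ (∑-concatMap f xs g))

  ∑-filter : ∀ (q : A → Bool) xs g → ∑ (filterᵇ q xs) g ≈ ∑[ x ∈ xs ] (if q x then g x else 0#)
  ∑-filter q [] g = ≈-refl
  ∑-filter q (x ∷ xs) g with q x
  ... | true  = +-congˡ (∑-filter q xs g)
  ... | false = ≈-trans (∑-filter q xs g) (≈-sym (+-identityˡ _))

  ∑-zero : ∀ (xs : List A) → ∑[ x ∈ xs ] 0# ≈ 0#
  ∑-zero [] = ≈-refl
  ∑-zero (x ∷ xs) = ≈-trans (+-identityˡ _) (∑-zero xs)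

  ∑-+ : ∀ (xs : List A) g h → ∑[ x ∈ xs ] (g x +ᴿ h x) ≈ ∑ xs g +ᴿ ∑ xs h
  ∑-+ [] g h = ≈-sym (+-identityˡ _)
  ∑-+ (x ∷ xs) g h = begin
    (g x +ᴿ h x) +ᴿ ∑[ x ∈ xs ] (g x +ᴿ h x) ≈⟨ +-congˡ (∑-+ xs g h) ⟩
    (g x +ᴿ h x) +ᴿ (∑ xs g +ᴿ ∑ xs h)       ≈⟨ +-interchange _ _ _ _ ⟩
    (g x +ᴿ ∑ xs g) +ᴿ (h x +ᴿ ∑ xs h)       ∎

  ∑-swap : ∀ (xs : List A) (ys : List B) (g : A → B → Carrier) →
           ∑[ x ∈ xs ] ∑[ y ∈ ys ] g x y ≈ ∑[ y ∈ ys ] ∑[ x ∈ xs ] g x y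
  ∑-swap [] ys g = ≈-sym (∑-zero ys)
  ∑-swap (x ∷ xs) ys g = ≈-trans (+-congˡ (∑-swap xs ys g)) (≈-sym (∑-+ ys (g x) _))

  ∑-*ˡ : ∀ k (xs : List A) g → k *ᴿ ∑ xs g ≈ ∑[ x ∈ xs ] (k *ᴿ g x)
  ∑-*ˡ k [] g = zeroʳ k
  ∑-*ˡ k (x ∷ xs) g = ≈-trans (distribˡ k _ _) (+-congˡ (∑-*ˡ k xs g))

  ∑-neg : ∀ (xs : List A) g → - ∑ xs g ≈ ∑[ x ∈ xs ] (- g x)
  ∑-neg [] g = -0#≈0#
  ∑-neg (x ∷ xs) g = ≈-trans (≈-sym (-‿+-comm _ _)) (+-congˡ (∑-neg xs g))

  ∑-product : ∀ (xs : List A) (ys : List B) (g : A → Carrier) (h : B → Carrier) →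
              ∑[ x ∈ xs ] ∑[ y ∈ ys ] (g x *ᴿ h y) ≈ ∑ xs g *ᴿ ∑ ys h
  ∑-product xs ys g h = begin
    ∑[ x ∈ xs ] ∑[ y ∈ ys ] (g x *ᴿ h y) ≈⟨ ∑-cong xs (λ x → ∑-*ˡ (g x) ys h) ⟨
    ∑[ x ∈ xs ] (g x *ᴿ ∑ ys h)          ≈⟨ ∑-cong xs (λ x → *-comm (g x) _) ⟩
    ∑[ x ∈ xs ] (∑ ys h *ᴿ g x)          ≈⟨ ∑-*ˡ (∑ ys h) xs g ⟨
    ∑ ys h *ᴿ ∑ xs g                     ≈⟨ *-comm _ _ ⟩
    ∑ xs g *ᴿ ∑ ys h                     ∎

  weight : F → (Word → Bool) → Carrier
  weight x Q = ∑[ p ∈ x ] (if Q (proj₂ p) then proj₁ p else 0#)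

  weight-⊕ : ∀ x y Q → weight (x ⊕ y) Q ≈ weight x Q +ᴿ weight y Q
  weight-⊕ x y Q = ∑-++ x y _

  weight-neg : ∀ x Q → weight (neg x) Q ≈ - weight x Q
  weight-neg x Q = begin
    weight (neg x) Q                                 ≡⟨ ∑-map _ x _ ⟩
    ∑[ p ∈ x ] (if Q (proj₂ p) then - proj₁ p else 0#) ≈⟨ ∑-cong x (λ p → if-neg (Q (proj₂ p))) ⟩
    ∑[ p ∈ x ] (- (if Q (proj₂ p) then proj₁ p else 0#)) ≈⟨ ∑-neg x _ ⟨
    - weight x Q                                     ∎
    where
    if-neg : ∀ b {a} → (if b then - a else 0#) ≈ - (if b then a else 0#)
    if-neg true = ≈-refl
    if-neg false = ≈-sym -0#≈0#

  weight-⊗ : ∀ x y Q → weight (x ⊗ y) Q ≈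
    ∑[ p ∈ x ] ∑[ q ∈ y ] (if Q (proj₂ p ++ proj₂ q) then proj₁ p *ᴿ proj₁ q else 0#)
  weight-⊗ x y Q = ≈-trans (∑-concatMap _ x _) (∑-cong x (λ p → ≈-reflexive (∑-map _ y _)))

  Multilinear : List ℕ → F → Set c
  Multilinear S x = All (λ p → proj₂ p ↭ S) x

  Multilinear-resp-↭ : ∀ {S T x} → S ↭ T → Multilinear S x → Multilinear T x
  Multilinear-resp-↭ S↭T = All.map (λ v↭S → ↭-trans v↭S S↭T)

  Multilinear-⊗ : ∀ {S T x y} → Multilinear S x → Multilinear T y → Multilinear (S ++ T) (x ⊗ y)
  Multilinear-⊗ [] my = []
  Multilinear-⊗ {y = y} (v↭S ∷ mx) my = ++⁺ (map⁺ (All.map (++⁺-↭ v↭S) my)) (Multilinear-⊗ mx my)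

  Multilinear-bracket : ∀ {S x} t → Multilinear S x → Multilinear (S ∷ʳ t) (bracket x (letter t))
  Multilinear-bracket {S} t mx =
    ++⁺ (Multilinear-⊗ mx (↭-refl ∷ [])) (map⁺ (Multilinear-resp-↭ (∷↭∷ʳ t S) (Multilinear-⊗ (↭-refl ∷ []) mx)))

  VS-∷ʳ : ∀ s ss t → VS ((s ∷ ss) ∷ʳ t) ≡ bracket (VS (s ∷ ss)) (letter t)
  VS-∷ʳ s ss t = foldl-∷ʳ _ (letter s) t ss

  VS-interval-suc : ∀ s a → VS (interval s (suc (suc a))) ≡ bracket (VS (interval s (suc a))) (letter (s + suc (suc a)))
  VS-interval-suc s a = trans (cong VS (interval-∷ʳ s (suc a))) (VS-∷ʳ (suc s) (interval (suc s) a) _)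

  Multilinear-VS : ∀ s a → Multilinear (interval s a) (VS (interval s a))
  Multilinear-VS s zero = ↭-refl ∷ []
  Multilinear-VS s (suc zero) = ↭-refl ∷ []
  Multilinear-VS s (suc (suc a)) =
    subst₂ Multilinear (sym (interval-∷ʳ s (suc a))) (sym (VS-interval-suc s a)) (Multilinear-bracket _ (Multilinear-VS s (suc a)))

  weight-one : ∀ C → weight one (respectsAll C) ≈ 1#
  weight-one C rewrite allᵇ-true {q = λ c → respects c []} (λ _ → refl) C = +-identityʳ 1#

  weight-letter : ∀ C t → weight (letter t) (respectsAll C) ≈ 1#
  weight-letter C t rewrite respectsAll-[ t ] C = +-identityʳ 1#

  if-∧-∧-not : ∀ b₁ b₂ b₃ a₁ a₂ → (if b₁ ∧ (b₂ ∧ not b₃) then a₁ *ᴿ a₂ else 0#) ≈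
               (if b₃ then 0# else (if b₁ then a₁ else 0#) *ᴿ (if b₂ then a₂ else 0#))
  if-∧-∧-not false b₂ true  a₁ a₂ = ≈-refl
  if-∧-∧-not true false true a₁ a₂ = ≈-refl
  if-∧-∧-not true true true a₁ a₂ = ≈-refl
  if-∧-∧-not false b₂ false a₁ a₂ = ≈-sym (zeroˡ _)
  if-∧-∧-not true false false a₁ a₂ = ≈-sym (zeroʳ a₁)
  if-∧-∧-not true true false a₁ a₂ = ≈-refl

  weight-⊗-disjoint : ∀ C {S T x y} → Multilinear S x → Multilinear T y → Disjoint S T →
    weight (x ⊗ y) (respectsAll C) ≈
    (if backward C S T then 0# else weight x (respectsAll C) *ᴿ weight y (respectsAll C))
  weight-⊗-disjoint C {S} {T} {x} {y} mx my S#T = begin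
    weight (x ⊗ y) (respectsAll C)
      ≈⟨ weight-⊗ x y _ ⟩
    ∑[ p ∈ x ] ∑[ q ∈ y ] (if respectsAll C (proj₂ p ++ proj₂ q) then proj₁ p *ᴿ proj₁ q else 0#)
      ≈⟨ ∑-congᴬ mx (λ v↭S → ∑-congᴬ my (λ v′↭T → term v↭S v′↭T)) ⟩
    ∑[ p ∈ x ] ∑[ q ∈ y ] (if backward C S T then 0# else ω p *ᴿ ω q)
      ≈⟨ factor (backward C S T) ⟩
    (if backward C S T then 0# else weight x (respectsAll C) *ᴿ weight y (respectsAll C)) ∎
    where
    ω : Carrier × Word → Carrier
    ω (a , v) = if respectsAll C v then a else 0#

    term : ∀ {p q} → proj₂ p ↭ S → proj₂ q ↭ T →
      (if respectsAll C (proj₂ p ++ proj₂ q) then proj₁ p *ᴿ proj₁ q else 0#) ≈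
      (if backward C S T then 0# else ω p *ᴿ ω q)
    term {a , v} {b , v′} v↭S v′↭T
      rewrite respectsAll-++ C v v′ (Disjoint-resp-↭ v↭S v′↭T S#T) | backward-resp-↭ C v↭S v′↭T =
      if-∧-∧-not (respectsAll C v) (respectsAll C v′) (backward C S T) a b

    factor : ∀ b → ∑[ p ∈ x ] ∑[ q ∈ y ] (if b then 0# else ω p *ᴿ ω q) ≈
                   (if b then 0# else weight x (respectsAll C) *ᴿ weight y (respectsAll C))
    factor true = ≈-trans (∑-cong x (λ _ → ∑-zero y)) (∑-zero x)
    factor false = ∑-product x y ω ω

  if-0-cong : ∀ b {a a′} → a ≈ a′ → (if b then 0# else a) ≈ (if b then 0# else a′)
  if-0-cong true _ = ≈-refl
  if-0-cong false a≈a′ = a≈a′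

  weight-bracket : ∀ C {S x} t → Multilinear S x → t ∉ S →
    weight (bracket x (letter t)) (respectsAll C) ≈
    (if backward C S [ t ] then 0# else weight x (respectsAll C))
      - (if backward C [ t ] S then 0# else weight x (respectsAll C))
  weight-bracket C {S} {x} t mx t∉S = begin
    weight (bracket x (letter t)) (respectsAll C)
      ≈⟨ weight-⊕ (x ⊗ letter t) _ _ ⟩
    weight (x ⊗ letter t) (respectsAll C) +ᴿ weight (neg (letter t ⊗ x)) (respectsAll C)
      ≈⟨ +-cong (weight-⊗-disjoint C mx (↭-refl ∷ []) S#t) (≈-trans (weight-neg (letter t ⊗ x) (respectsAll C)) (-‿cong (weight-⊗-disjoint C (↭-refl ∷ []) mx t#S))) ⟩
    (if backward C S [ t ] then 0# else W *ᴿ weight (letter t) (respectsAll C))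
      - (if backward C [ t ] S then 0# else weight (letter t) (respectsAll C) *ᴿ W)
      ≈⟨ +-cong (if-0-cong (backward C S [ t ]) (≈-trans (*-congˡ (weight-letter C t)) (*-identityʳ W)))
                (-‿cong (if-0-cong (backward C [ t ] S) (≈-trans (*-congʳ (weight-letter C t)) (*-identityˡ W)))) ⟩
    (if backward C S [ t ] then 0# else W) - (if backward C [ t ] S then 0# else W) ∎
    where
    W = weight x (respectsAll C)
    S#t : Disjoint S [ t ]
    S#t (z∈S , here refl) = t∉S z∈S
    t#S : Disjoint [ t ] S
    t#S (here refl , z∈S) = t∉S z∈S

  weight-VS-suc : ∀ C s a → weight (VS (interval s (suc (suc a)))) (respectsAll C) ≈
    (if backward C (interval s (suc a)) [ s + suc (suc a) ] then 0# else weight (VS (interval s (suc a))) (respectsAll C))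
      - (if backward C [ s + suc (suc a) ] (interval s (suc a)) then 0# else weight (VS (interval s (suc a))) (respectsAll C))
  weight-VS-suc C s a rewrite VS-interval-suc s a =
    weight-bracket C _ (Multilinear-VS s (suc a)) (interval-last∉ s (suc a))

  -- Lie monomials on intervals

  if-0-zero : ∀ b {a} → a ≈ 0# → (if b then 0# else a) ≈ 0#
  if-0-zero true _ = ≈-refl
  if-0-zero false a≈0 = a≈0

  weight-VS-suc-≈0 : ∀ C s a → weight (VS (interval s (suc a))) (respectsAll C) ≈ 0# →
    weight (VS (interval s (suc (suc a)))) (respectsAll C) ≈ 0#
  weight-VS-suc-≈0 C s a W≈0 =
    ≈-trans (weight-VS-suc C s a) (≈-trans (+-cong (if-0-zero _ W≈0) (-‿cong (if-0-zero _ W≈0))) (-‿inverseʳ 0#))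

  weight-VS-suc-unlinked : ∀ C s a →
    backward C (interval s (suc a)) [ s + suc (suc a) ] ≡ false →
    backward C [ s + suc (suc a) ] (interval s (suc a)) ≡ false →
    weight (VS (interval s (suc (suc a)))) (respectsAll C) ≈ 0#
  weight-VS-suc-unlinked C s a ¬bk₁ ¬bk₂ = begin
    weight (VS (interval s (suc (suc a)))) (respectsAll C)                       ≈⟨ weight-VS-suc C s a ⟩
    (if backward C I [ t ] then 0# else W) - (if backward C [ t ] I then 0# else W)
      ≡⟨ cong₂ (λ b₁ b₂ → (if b₁ then 0# else W) - (if b₂ then 0# else W)) ¬bk₁ ¬bk₂ ⟩
    W - W                                                                        ≈⟨ -‿inverseʳ W ⟩
    0#                                                                           ∎
    where
    I = interval s (suc a)
    t = s + suc (suc a)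
    W = weight (VS I) (respectsAll C)

  weight-VS-suc-chained : ∀ C s a → Chained C s (suc (suc a)) →
    weight (VS (interval s (suc (suc a)))) (respectsAll C) ≈
    (if backward C (interval s (suc a)) [ s + suc (suc a) ] then 0# else weight (VS (interval s (suc a))) (respectsAll C))
  weight-VS-suc-chained C s a ch = begin
    weight (VS (interval s (suc (suc a)))) (respectsAll C)                       ≈⟨ weight-VS-suc C s a ⟩
    (if backward C I [ t ] then 0# else W) - (if backward C [ t ] I then 0# else W)
      ≡⟨ cong (λ b → (if backward C I [ t ] then 0# else W) - (if b then 0# else W)) (Chained⇒backward ch) ⟩
    (if backward C I [ t ] then 0# else W) - 0#                                 ≈⟨ +-congˡ -0#≈0# ⟩
    (if backward C I [ t ] then 0# else W) +ᴿ 0#                                ≈⟨ +-identityʳ _ ⟩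
    (if backward C I [ t ] then 0# else W)                                      ∎
    where
    I = interval s (suc a)
    t = s + suc (suc a)
    W = weight (VS I) (respectsAll C)

  weight-VS-two-coloured-suc : ∀ C (κ : ℕ → ℕ) → (∀ {x y} → (x , y) ∈ C → κ x ≡ κ y) → ∀ s a →
    (TwoColoured κ (interval s (suc a)) → weight (VS (interval s (suc a))) (respectsAll C) ≈ 0#) →
    TwoColoured κ (interval s (suc (suc a))) → weight (VS (interval s (suc (suc a)))) (respectsAll C) ≈ 0#
  weight-VS-two-coloured-suc C κ κ-resp s a ih tc
    with backward C (interval s (suc a)) [ s + suc (suc a) ] in bk₁
       | backward C [ s + suc (suc a) ] (interval s (suc a)) in bk₂
  ... | false | false = weight-VS-suc-unlinked C s a bk₁ bk₂
  ... | true | _ with backward⇒∃ C (interval s (suc a)) [ s + suc (suc a) ] bk₁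
  ...   | _ , _ , xy∈C , y∈I , here refl =
          weight-VS-suc-≈0 C s a (ih (TwoColoured-interval-suc tc y∈I (sym (κ-resp xy∈C))))
  weight-VS-two-coloured-suc C κ κ-resp s a ih tc | false | true
    with backward⇒∃ C [ s + suc (suc a) ] (interval s (suc a)) bk₂
  ...   | _ , _ , xy∈C , here refl , x∈I =
          weight-VS-suc-≈0 C s a (ih (TwoColoured-interval-suc tc x∈I (κ-resp xy∈C)))

  weight-VS-two-coloured : ∀ C (κ : ℕ → ℕ) → (∀ {x y} → (x , y) ∈ C → κ x ≡ κ y) →
    ∀ s a → TwoColoured κ (interval s a) → weight (VS (interval s a)) (respectsAll C) ≈ 0#
  weight-VS-two-coloured C κ κ-resp s zero (_ , _ , () , _)
  weight-VS-two-coloured C κ κ-resp s (suc zero) (_ , _ , here refl , here refl , κx≢κx) = ⊥-elim (κx≢κx refl)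
  weight-VS-two-coloured C κ κ-resp s (suc (suc a)) =
    weight-VS-two-coloured-suc C κ κ-resp s a (weight-VS-two-coloured C κ κ-resp s (suc a))

  weight-VS-ascending-suc : ∀ C s a → Chained C s (suc (suc a)) → AscendingOn C (interval s (suc (suc a))) →
    (Chained C s (suc a) → weight (VS (interval s (suc a))) (respectsAll C) ≈ 1#) →
    weight (VS (interval s (suc (suc a)))) (respectsAll C) ≈ 1#
  weight-VS-ascending-suc C s a ch asc ih
    with backward C (interval s (suc a)) [ s + suc (suc a) ] in bk | weight-VS-suc-chained C s a ch
  ... | false | step = ≈-trans step (ih (Chained-suc ch bk))
  ... | true | _ with backward⇒∃ C (interval s (suc a)) [ s + suc (suc a) ] bk
  ...   | _ , _ , ty∈C , y∈I , here refl = ⊥-elim (ℕ.<-irrefl refl (ℕ.≤-<-trans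
            (asc ty∈C (∈-interval-sucʳ s (suc a)) (∈-interval-sucˡ s (suc a) y∈I))
            (ℕ.≤-<-trans (proj₂ (∈-interval⁻ s (suc a) y∈I)) (ℕ.+-monoʳ-< s (ℕ.n<1+n (suc a))))))

  weight-VS-ascending : ∀ C s a → Chained C s a → AscendingOn C (interval s a) →
    weight (VS (interval s a)) (respectsAll C) ≈ 1#
  weight-VS-ascending C s zero _ _ = weight-one C
  weight-VS-ascending C s (suc zero) _ _ = weight-letter C (suc s)
  weight-VS-ascending C s (suc (suc a)) ch asc = weight-VS-ascending-suc C s a ch asc
    (λ ch′ → weight-VS-ascending C s (suc a) ch′ λ xy∈C x∈ y∈ → asc xy∈C (∈-interval-sucˡ s (suc a) x∈) (∈-interval-sucˡ s (suc a) y∈))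

  weight-VS-descent-suc : ∀ C s a → Chained C s (suc (suc a)) → DescentOn C (interval s (suc (suc a))) →
    (Chained C s (suc a) → DescentOn C (interval s (suc a)) → weight (VS (interval s (suc a))) (respectsAll C) ≈ 0#) →
    weight (VS (interval s (suc (suc a)))) (respectsAll C) ≈ 0#
  weight-VS-descent-suc C s a ch (x , y , xy∈C , x∈ , y∈ , y<x) ih
    with backward C (interval s (suc a)) [ s + suc (suc a) ] in bk | weight-VS-suc-chained C s a ch
  ... | true | step = step
  ... | false | step with ∈-interval-suc⁻ s (suc a) x∈ | ∈-interval-suc⁻ s (suc a) y∈
  ...   | _ | inj₂ refl = ⊥-elim (ℕ.<-irrefl refl (ℕ.<-≤-trans y<x (proj₂ (∈-interval⁻ s (suc (suc a)) x∈))))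
  ...   | inj₂ refl | inj₁ y∈I = ⊥-elim (¬backward⇒∄ C (interval s (suc a)) [ s + suc (suc a) ] bk xy∈C y∈I (here refl))
  ...   | inj₁ x∈I | inj₁ y∈I = ≈-trans step (ih (Chained-suc ch bk) (x , y , xy∈C , x∈I , y∈I , y<x))

  weight-VS-descent : ∀ C s a → Chained C s a → DescentOn C (interval s a) →
    weight (VS (interval s a)) (respectsAll C) ≈ 0#
  weight-VS-descent C s zero _ (_ , _ , _ , () , _)
  weight-VS-descent C s (suc zero) _ (_ , _ , _ , here refl , here refl , x<x) = ⊥-elim (ℕ.<-irrefl refl x<x)
  weight-VS-descent C s (suc (suc a)) ch desc = weight-VS-descent-suc C s a ch desc (weight-VS-descent C s (suc a))

  -- Vb 0 α is Vbold α; the offset s lets the recursion run over the blocks.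
  Vb : ℕ → List ℕ → F
  Vb s α = foldr _⊗_ one (map VS (setsFrom s α))

  Multilinear-Vb : ∀ s α → Multilinear (interval s (sumℕ α)) (Vb s α)
  Multilinear-Vb s [] = ↭-refl ∷ []
  Multilinear-Vb s (a ∷ α) =
    subst (λ S → Multilinear S (Vb s (a ∷ α))) (interval-++ s a (sumℕ α)) (Multilinear-⊗ (Multilinear-VS s a) (Multilinear-Vb (s + a) α))

  weight-Vb-∷ : ∀ C s a α → weight (Vb s (a ∷ α)) (respectsAll C) ≈
    (if backward C (interval s a) (interval (s + a) (sumℕ α)) then 0#
     else weight (VS (interval s a)) (respectsAll C) *ᴿ weight (Vb (s + a) α) (respectsAll C))
  weight-Vb-∷ C s a α = weight-⊗-disjoint C (Multilinear-VS s a) (Multilinear-Vb (s + a) α) (interval-disjoint s a (sumℕ α))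

  weight-Vb-zero : ∀ C s α {t b} → Block s α t b → weight (VS (interval t b)) (respectsAll C) ≈ 0# →
    weight (Vb s α) (respectsAll C) ≈ 0#
  weight-Vb-zero C s (a ∷ α) (inj₁ (refl , refl)) W≈0 =
    ≈-trans (weight-Vb-∷ C s a α) (if-0-zero _ (≈-trans (*-congʳ W≈0) (zeroˡ _)))
  weight-Vb-zero C s (a ∷ α) (inj₂ blk) W≈0 =
    ≈-trans (weight-Vb-∷ C s a α) (if-0-zero _ (≈-trans (*-congˡ (weight-Vb-zero C (s + a) α blk W≈0)) (zeroʳ _)))

  weight-Vb-one : ∀ C → (∀ {x y} → (x , y) ∈ C → x ≤ y) → ∀ s α →
    (∀ {t b} → Block s α t b → weight (VS (interval t b)) (respectsAll C) ≈ 1#) →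
    weight (Vb s α) (respectsAll C) ≈ 1#
  weight-Vb-one C asc s [] _ = weight-one C
  weight-Vb-one C asc s (a ∷ α) blocks≈1 = begin
    weight (Vb s (a ∷ α)) (respectsAll C)                    ≈⟨ weight-Vb-∷ C s a α ⟩
    (if backward C (interval s a) (interval (s + a) (sumℕ α)) then 0#
     else weight (VS (interval s a)) (respectsAll C) *ᴿ weight (Vb (s + a) α) (respectsAll C))
      ≡⟨ cong (λ b → if b then 0# else weight (VS (interval s a)) (respectsAll C) *ᴿ weight (Vb (s + a) α) (respectsAll C)) no-backward ⟩
    weight (VS (interval s a)) (respectsAll C) *ᴿ weight (Vb (s + a) α) (respectsAll C)
      ≈⟨ *-cong (blocks≈1 (inj₁ (refl , refl))) (weight-Vb-one C asc (s + a) α (blocks≈1 ∘ inj₂)) ⟩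
    1# *ᴿ 1#                                                    ≈⟨ *-identityˡ 1# ⟩
    1#                                                         ∎
    where
    no-backward : backward C (interval s a) (interval (s + a) (sumℕ α)) ≡ false
    no-backward = ∄⇒¬backward C (interval s a) (interval (s + a) (sumℕ α)) λ xy∈C y∈ x∈ →
      ℕ.<-irrefl refl (ℕ.≤-<-trans (asc xy∈C) (ℕ.≤-<-trans (proj₂ (∈-interval⁻ s a y∈)) (proj₁ (∈-interval⁻ (s + a) (sumℕ α) x∈))))

  -- The coefficient as a weight

  nth-indexOf : ∀ {x v} → x ∈ v → nth v (indexOf x v) ≡ x
  nth-indexOf {x} {z ∷ zs} x∈ with x ≡ᵇ z | ≡ᵇ-reflects x z
  ... | true  | ofʸ refl = refl
  ... | false | ofⁿ x≢z = nth-indexOf (Any.tail x≢z x∈)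

  indexOf<length : ∀ {x v} → x ∈ v → indexOf x v < length v
  indexOf<length {x} {z ∷ zs} x∈ with x ≡ᵇ z | ≡ᵇ-reflects x z
  ... | true  | _ = s≤s z≤n
  ... | false | ofⁿ x≢z = s≤s (indexOf<length (Any.tail x≢z x∈))

  nth∈ : ∀ v {k} → k < length v → nth v k ∈ v
  nth∈ (z ∷ zs) {zero} _ = here refl
  nth∈ (z ∷ zs) {suc k} (s≤s k<) = there (nth∈ zs k<)

  indexOf-nth : ∀ {v k} → Unique v → k < length v → indexOf (nth v k) v ≡ k
  indexOf-nth {z ∷ zs} {zero} _ _ with z ≡ᵇ z | ≡ᵇ-reflects z z
  ... | true  | _ = refl
  ... | false | ofⁿ z≢z = ⊥-elim (z≢z refl)
  indexOf-nth {z ∷ zs} {suc k} (z≢zs ∷ uniq) (s≤s k<) with nth zs k ≡ᵇ z | ≡ᵇ-reflects (nth zs k) z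
  ... | true  | ofʸ eq = ⊥-elim (All.lookup z≢zs (nth∈ zs k<) (sym eq))
  ... | false | _ = cong suc (indexOf-nth uniq k<)

  nth-map-allFin : ∀ {n} (f : Fin n → ℕ) k → nth (map f (allFin n)) (toℕ k) ≡ f k
  nth-map-allFin {suc n} f fzero = refl
  nth-map-allFin {suc n} f (fsuc k) =
    trans (cong (λ l → nth l (toℕ k)) (trans (map-tabulate fsuc f) (sym (map-tabulate id (f ∘ fsuc)))))
          (nth-map-allFin (f ∘ fsuc) k)

  map-allFin-injective : ∀ {n} {f g : Fin n → ℕ} → map f (allFin n) ≡ map g (allFin n) → ∀ k → f k ≡ g k
  map-allFin-injective {f = f} {g} eq k =
    trans (sym (nth-map-allFin f k)) (trans (cong (λ l → nth l (toℕ k)) eq) (nth-map-allFin g k))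

  ∑-allFin-single : ∀ {n} (g : Fin n → Carrier) x₀ → (∀ x → x ≢ x₀ → g x ≈ 0#) → ∑ (allFin n) g ≈ g x₀
  ∑-allFin-single {suc n} g x₀ g≈0 = begin
    g fzero +ᴿ ∑ (tabulate fsuc) g           ≡⟨ cong (λ xs → g fzero +ᴿ ∑ xs g) (sym (map-tabulate id fsuc)) ⟩
    g fzero +ᴿ ∑ (map fsuc (allFin n)) g     ≡⟨ cong (g fzero +ᴿ_) (∑-map fsuc (allFin n) g) ⟩
    g fzero +ᴿ ∑ (allFin n) (g ∘ fsuc)       ≈⟨ split x₀ g≈0 ⟩
    g x₀                                      ∎
    where
    split : ∀ x₀ → (∀ x → x ≢ x₀ → g x ≈ 0#) → g fzero +ᴿ ∑ (allFin n) (g ∘ fsuc) ≈ g x₀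
    split fzero g≈0 = ≈-trans (+-congˡ (≈-trans (∑-cong (allFin n) (λ x → g≈0 (fsuc x) λ ())) (∑-zero (allFin n)))) (+-identityʳ _)
    split (fsuc x₀) g≈0 = ≈-trans (+-cong (g≈0 fzero λ ()) (∑-allFin-single (g ∘ fsuc) x₀ (λ x x≢x₀ → g≈0 (fsuc x) (x≢x₀ ∘ Fin.suc-injective))))
                                  (+-identityˡ _)

  ∑-allVecs-single : ∀ n k (g : Vec (Fin n) k → Carrier) v₀ → (∀ v → v ≢ v₀ → g v ≈ 0#) → ∑ (allVecs n k) g ≈ g v₀
  ∑-allVecs-single n zero g [] _ = +-identityʳ _
  ∑-allVecs-single n (suc k) g (x₀ ∷ v₀) g≈0 = begin
    ∑ (allVecs n (suc k)) g                              ≈⟨ ∑-concatMap _ (allVecs n k) g ⟩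
    ∑[ v ∈ allVecs n k ] ∑ (map (_∷ v) (allFin n)) g     ≈⟨ ∑-cong (allVecs n k) (λ v → ≈-reflexive (∑-map (_∷ v) (allFin n) g)) ⟩
    ∑[ v ∈ allVecs n k ] ∑[ x ∈ allFin n ] g (x ∷ v)     ≈⟨ ∑-cong (allVecs n k) (λ v → ∑-allFin-single _ x₀ (λ x x≢x₀ → g≈0 (x ∷ v) (x≢x₀ ∘ Vec.∷-injectiveˡ))) ⟩
    ∑[ v ∈ allVecs n k ] g (x₀ ∷ v)                      ≈⟨ ∑-allVecs-single n k _ v₀ (λ v v≢v₀ → g≈0 (x₀ ∷ v) (v≢v₀ ∘ Vec.∷-injectiveʳ)) ⟩
    g (x₀ ∷ v₀)                                          ∎

  -- For a rearrangement v of 1, …, n exactly one σ has (v · σ) · u = w, and it lies in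
  -- BSet n γ exactly when v respects the constraints of γ.

  module Rearranging {m} (u w : Permutation′ (suc m)) {v : Word} (v↭ : v ↭ interval 0 (suc m)) where

    matches : (Fin (suc m) → Fin (suc m)) → Bool
    matches σ = does (≡-dec ℕ._≟_ (actWord (actWord v σ) (u ⟨$⟩ʳ_)) (underline w))

    length-v : length v ≡ suc m
    length-v = trans (↭-length v↭) (length-interval 0 (suc m))

    unique-v : Unique v
    unique-v = Unique-resp-↭ (↭⇒↭ₛ (↭-sym v↭)) (Unique-interval 0 (suc m))

    letter∈v : ∀ j → letterAt u w j ∈ v
    letter∈v j = ∈-resp-↭ (↭-sym v↭) (∈-interval⁺ 0 (suc m) (s≤s z≤n) (s≤s (ℕ.≤-pred (Fin.toℕ<n _))))

    σᵥ : Fin (suc m) → Fin (suc m)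
    σᵥ j = fromℕ< (subst (indexOf (letterAt u w j) v <_) length-v (indexOf<length (letter∈v j)))

    toℕ-σᵥ : ∀ j → toℕ (σᵥ j) ≡ indexOf (letterAt u w j) v
    toℕ-σᵥ j = Fin.toℕ-fromℕ< (subst (indexOf (letterAt u w j) v <_) length-v (indexOf<length (letter∈v j)))

    nth-actWord : ∀ (σ : Fin (suc m) → Fin (suc m)) k → nth (actWord v σ) (toℕ k) ≡ nth v (toℕ (σ k))
    nth-actWord σ = nth-map-allFin (λ k → nth v (toℕ (σ k)))

    matches⇒≗σᵥ : ∀ σ → matches σ ≡ true → ∀ j → σ j ≡ σᵥ j
    matches⇒≗σᵥ σ match j = Fin.toℕ-injective
      (trans (sym (indexOf-nth unique-v (subst (toℕ (σ j) <_) (sym length-v) (Fin.toℕ<n (σ j)))))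
      (trans (cong (λ x → indexOf x v) nth≡letter) (sym (toℕ-σᵥ j))))
      where
      pointwise : ∀ i → nth (actWord v σ) (toℕ (u ⟨$⟩ʳ i)) ≡ suc (toℕ (w ⟨$⟩ʳ i))
      pointwise = map-allFin-injective (reflects-witness (proof (≡-dec ℕ._≟_ (actWord (actWord v σ) (u ⟨$⟩ʳ_)) (underline w))) match)
      nth≡letter : nth v (toℕ (σ j)) ≡ letterAt u w j
      nth≡letter = trans (cong (λ k → nth v (toℕ (σ k))) (sym (inverseʳ u)))
                         (trans (sym (nth-actWord σ (u ⟨$⟩ʳ (u ⟨$⟩ˡ j)))) (pointwise (u ⟨$⟩ˡ j)))

    module _ (σ : Fin (suc m) → Fin (suc m)) (σ≗σᵥ : ∀ j → σ j ≡ σᵥ j) where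

      toℕ-σ : ∀ j → toℕ (σ j) ≡ indexOf (letterAt u w j) v
      toℕ-σ j = trans (cong toℕ (σ≗σᵥ j)) (toℕ-σᵥ j)

      matches-σᵥ : matches σ ≡ true
      matches-σᵥ = dec-true (≡-dec ℕ._≟_ (actWord (actWord v σ) (u ⟨$⟩ʳ_)) (underline w)) (map-cong pointwise (allFin (suc m)))
        where
        pointwise : ∀ i → nth (actWord v σ) (toℕ (u ⟨$⟩ʳ i)) ≡ suc (toℕ (w ⟨$⟩ʳ i))
        pointwise i = trans (nth-actWord σ (u ⟨$⟩ʳ i))
                     (trans (cong (nth v) (toℕ-σ (u ⟨$⟩ʳ i)))
                     (trans (nth-indexOf (letter∈v (u ⟨$⟩ʳ i))) (cong (λ k → suc (toℕ (w ⟨$⟩ʳ k))) (inverseˡ u))))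

      indexOf-injective : ∀ {i j} → indexOf (letterAt u w i) v ≡ indexOf (letterAt u w j) v → i ≡ j
      indexOf-injective {i} {j} eq = letterAt-injective u w
        (trans (sym (nth-indexOf (letter∈v i))) (trans (cong (nth v) eq) (nth-indexOf (letter∈v j))))

      injectiveᵇ-σᵥ : injectiveᵇ σ ≡ true
      injectiveᵇ-σᵥ = injectiveᵇ-intro σ (λ {i} {j} eq → indexOf-injective (trans (sym (toℕ-σ i)) (trans (cong toℕ eq) (toℕ-σ j))))

      Des⊆-σᵥ : ∀ PS → allᵇ (λ d → memℕ d PS) (Des σ) ≡ respectsAll (constraints PS (letterAt u w)) v
      Des⊆-σᵥ PS = trans (Des⊆-allFin PS m σ) (trans (allᵇ-cong (allFin m) pointwise) (sym (respectsAll-constraints PS (letterAt u w) v)))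
        where
        pointwise : ∀ i → (not (toℕ (σ (fsuc i)) <ᵇ toℕ (σ (inject₁ i))) ∨ memℕ (suc (toℕ i)) PS) ≡
                          (memℕ (suc (toℕ i)) PS ∨ respects (letterAt u w (inject₁ i) , letterAt u w (fsuc i)) v)
        pointwise i rewrite toℕ-σ (fsuc i) | toℕ-σ (inject₁ i)
                          | not-<ᵇ (inject₁≢fsuc i ∘ indexOf-injective {inject₁ i} {fsuc i})
                          | respects-indexOf unique-v (letter∈v (inject₁ i)) (letter∈v (fsuc i)) (inject₁≢fsuc i ∘ letterAt-injective u w)
          = ∨-comm (indexOf (letterAt u w (inject₁ i)) v <ᵇ indexOf (letterAt u w (fsuc i)) v) (memℕ (suc (toℕ i)) PS)

    ∑-BSet-matches : ∀ γ a → ∑[ σ ∈ BSet (suc m) γ ] (if matches σ then a else 0#) ≈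
                             (if respectsAll (constraints (partialSums γ) (letterAt u w)) v then a else 0#)
    ∑-BSet-matches γ a = begin
      ∑[ σ ∈ BSet (suc m) γ ] (if matches σ then a else 0#)
        ≈⟨ ∑-filter D (Sym (suc m)) _ ⟩
      ∑[ σ ∈ Sym (suc m) ] (if D σ then (if matches σ then a else 0#) else 0#)
        ≈⟨ ∑-filter injectiveᵇ (map Vec.lookup (allVecs (suc m) (suc m))) _ ⟩
      ∑[ σ ∈ map Vec.lookup (allVecs (suc m) (suc m)) ] term σ
        ≡⟨ ∑-map Vec.lookup (allVecs (suc m) (suc m)) term ⟩
      ∑[ vc ∈ allVecs (suc m) (suc m) ] term (Vec.lookup vc)
        ≈⟨ ∑-allVecs-single (suc m) (suc m) (term ∘ Vec.lookup) (Vec.tabulate σᵥ) off-σᵥ ⟩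
      term (Vec.lookup (Vec.tabulate σᵥ))
        ≡⟨ at-σᵥ ⟩
      (if respectsAll (constraints (partialSums γ) (letterAt u w)) v then a else 0#) ∎
      where
      D : (Fin (suc m) → Fin (suc m)) → Bool
      D σ = allᵇ (λ d → memℕ d (partialSums γ)) (Des σ)

      term : (Fin (suc m) → Fin (suc m)) → Carrier
      term σ = if injectiveᵇ σ then (if D σ then (if matches σ then a else 0#) else 0#) else 0#

      off-σᵥ : ∀ vc → vc ≢ Vec.tabulate σᵥ → term (Vec.lookup vc) ≈ 0#
      off-σᵥ vc vc≢ with matches (Vec.lookup vc) in match
      ... | true = ⊥-elim (vc≢ (trans (sym (Vec.tabulate∘lookup vc)) (Vec.tabulate-cong (matches⇒≗σᵥ (Vec.lookup vc) match))))
      ... | false with injectiveᵇ (Vec.lookup vc) | D (Vec.lookup vc)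
      ...   | true  | true  = ≈-refl
      ...   | true  | false = ≈-refl
      ...   | false | _     = ≈-refl

      at-σᵥ : term (Vec.lookup (Vec.tabulate σᵥ)) ≡ (if respectsAll (constraints (partialSums γ) (letterAt u w)) v then a else 0#)
      at-σᵥ rewrite injectiveᵇ-σᵥ _ (Vec.lookup∘tabulate σᵥ) | matches-σᵥ _ (Vec.lookup∘tabulate σᵥ)
                  | Des⊆-σᵥ _ (Vec.lookup∘tabulate σᵥ) (partialSums γ) with respectsAll (constraints (partialSums γ) (letterAt u w)) v
      ... | true  = refl
      ... | false = refl

  coeff-VBu : ∀ m β γ (u w : Permutation′ (suc m)) → sumℕ β ≡ suc m →
    coeff (VBu (suc m) β γ u) (underline w) ≈ weight (Vbold β) (respectsAll (constraints (partialSums γ) (letterAt u w)))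
  coeff-VBu m β γ u w Σβ = begin
    coeff (VBu (suc m) β γ u) (underline w)
      ≡⟨ ∑-map _ (actSum (Vbold β) L) _ ⟩
    ∑[ p ∈ actSum (Vbold β) L ] (if eqW (actWord (proj₂ p) (u ⟨$⟩ʳ_)) then proj₁ p else 0#)
      ≈⟨ ∑-concatMap (act (Vbold β)) L _ ⟩
    ∑[ σ ∈ L ] ∑[ p ∈ act (Vbold β) σ ] (if eqW (actWord (proj₂ p) (u ⟨$⟩ʳ_)) then proj₁ p else 0#)
      ≈⟨ ∑-cong L (λ σ → ≈-reflexive (∑-map _ (Vbold β) _)) ⟩
    ∑[ σ ∈ L ] ∑[ p ∈ Vbold β ] (if eqW (actWord (actWord (proj₂ p) σ) (u ⟨$⟩ʳ_)) then proj₁ p else 0#)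
      ≈⟨ ∑-swap L (Vbold β) _ ⟩
    ∑[ p ∈ Vbold β ] ∑[ σ ∈ L ] (if eqW (actWord (actWord (proj₂ p) σ) (u ⟨$⟩ʳ_)) then proj₁ p else 0#)
      ≈⟨ ∑-congᴬ multilinear (λ {p} v↭ → Rearranging.∑-BSet-matches u w v↭ γ (proj₁ p)) ⟩
    weight (Vbold β) (respectsAll (constraints (partialSums γ) (letterAt u w))) ∎
    where
    L = BSet (suc m) γ
    eqW : Word → Bool
    eqW v = does (≡-dec ℕ._≟_ v (underline w))
    multilinear : Multilinear (interval 0 (suc m)) (Vbold β)
    multilinear = subst (λ k → Multilinear (interval 0 k) (Vbold β)) Σβ (Multilinear-Vb 0 β)

  module _ {m} (u w : Permutation′ (suc m)) where
    open Comparing u w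

    coeff≈weight : coeff (VBu (suc m) β γ u) (underline w) ≈ weight (Vb 0 β) (respectsAll C)
    coeff≈weight = ≈-trans (coeff-VBu m β γ u w W.sumℕ-cLRM′)
      (≈-reflexive (cong (λ PS → weight (Vbold β) (respectsAll (constraints PS (letterAt u w)))) U.partialSums-cLRM′))

    weight-block-zero : ∀ (x₀ : Fin (suc m)) → weight (VS (W.block (toℕ x₀))) (respectsAll C) ≈ 0# →
      weight (Vb 0 β) (respectsAll C) ≈ 0#
    weight-block-zero x₀ = weight-Vb-zero C 0 β (W.Block-st (toℕ x₀))

    weight-zero : ¬ (∀ i → u ⟨$⟩ʳ i ≡ w ⟨$⟩ʳ i) → ¬ (sortDec β ≺π sortDec γ) → weight (Vb 0 β) (respectsAll C) ≈ 0#
    weight-zero u≢w ¬≺π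
      with ⊆-or-counterexample (λ x y → W.st (toℕ x) ℕ.≟ W.st (toℕ y)) (λ x y → colour x ℕ.≟ colour y)
    ... | inj₂ (x , y , st≡ , colour≢) =
      weight-block-zero x (weight-VS-two-coloured C κ κ-resp-C (W.st (toℕ x)) (W.en (toℕ x) ∸ W.st (toℕ x))
                                                  (TwoColoured-block st≡ colour≢))
    ... | inj₁ mono with ⊆-or-counterexample (λ x y → colour x ℕ.≟ colour y) (λ x y → W.st (toℕ x) ℕ.≟ W.st (toℕ y))
    ...   | inj₂ (x , y , colour≡ , st≢) = ⊥-elim (¬≺π (Refinement.¬Separating⇒≺π mono colour≡ st≢))
    ...   | inj₁ sep with All.all? (λ c → proj₁ c ℕ.≤? proj₂ c) C
    ...     | yes asc = ⊥-elim (u≢w (u≗w mono sep (All.lookup asc)))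
    ...     | no ¬asc with find (¬All⇒Any¬ (λ c → proj₁ c ℕ.≤? proj₂ c) C ¬asc)
    ...       | _ , xy∈ , x≰y with DescentOn-block mono sep xy∈ (ℕ.≰⇒> x≰y)
    ...         | x₀ , descent = weight-block-zero x₀ (weight-VS-descent C (W.st (toℕ x₀)) (W.en (toℕ x₀) ∸ W.st (toℕ x₀))
                                                                        (Chained-block mono sep x₀) descent)

    coeff-VBu-≈0 : ¬ (∀ i → u ⟨$⟩ʳ i ≡ w ⟨$⟩ʳ i) → ¬ (sortDec β ≺π sortDec γ) →
      coeff (VBu (suc m) β γ u) (underline w) ≈ 0#
    coeff-VBu-≈0 u≢w ¬≺π = ≈-trans coeff≈weight (weight-zero u≢w ¬≺π)

  coeff-VBu-≈1 : ∀ {m} (w : Permutation′ (suc m)) → coeff (VBu (suc m) (cLRM′ w) (cLRM′ w) w) (underline w) ≈ 1#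
  coeff-VBu-≈1 w = ≈-trans (coeff≈weight w w) (weight-Vb-one C ascending 0 β
    (λ {s} {a} blk → weight-VS-ascending C s a (Block⇒Chained blk) (λ xy∈ _ _ → ascending xy∈)))
    where open SelfComparison w

lemma5p3 : ∀ {c ℓ : Level} (R : CommutativeRing c ℓ) (n : ℕ) → 1 ≤ n →
    (w u : Permutation′ n) →
    let open CommutativeRing R
        open FreeAlg R
        β = cLRM′ w
        γ = cLRM′ u
    in (coeff (VBu n β β w) (underline w) ≈ 1#)
       × ((¬ (∀ i → u ⟨$⟩ʳ i ≡ w ⟨$⟩ʳ i)) → ¬ (sortDec β ≺π sortDec γ) →
          coeff (VBu n β γ u) (underline w) ≈ 0#)
lemma5p3 R (suc m) _ w u = coeff-VBu-≈1 R w , coeff-VBu-≈0 R u w
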